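{- Let $H$ be a simple graph satisfying $m(H) \ge 1$, let $b \in \mathbb{N}$, and let $H^{(b)}$ be the multigraph obtained from $H$ by duplicating each edge $b$ times (so each edge of $H$ appears with multiplicity $b$). Then there exists a partition of the edge multiset $H^{(b)} = H_1 \cup \ldots \cup H_k$, where $k = \lceil b \cdot m(H) \rceil$, such that for every $i \in [k]$, each connected component of $H_i$ is a simple unicyclic graph.
   Context: For a graph $H$, its density is $m(H) = \max_{H' \subseteq H} e(H')/v(H')$, where $e(\cdot)$ and $v(\cdot)$ denote numbers of edges and vertices. Graphs are identified with their edge sets. A graph is called unicyclic if it contains at most one cycle. -}

module Defs where

open import Data.Nat as ℕ using (ℕ; suc; NonZero)
open import Data.Fin using (Fin; toℕ)
open import Data.Fin.Subset using (Subset; _∈_; ∣_∣)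
open import Data.Integer using (ℤ; +_)
open import Data.Rational using (ℚ; _/_; _*_; _≤_; 1ℚ)
open import Data.List using (List; []; _∷_; length; head)
open import Data.List.Relation.Unary.Unique.Propositional using (Unique)
open import Data.List.Relation.Unary.Any using (Any)
open import Data.Maybe using (Maybe; just; nothing)
open import Data.Product using (Σ; _×_; _,_; proj₁; proj₂; ∃)
open import Data.Sum using (_⊎_)
open import Data.Empty using (⊥)
open import Data.Unit using (⊤)
open import Function.Definitions using (Injective)
open import Function.Bundles using (_⇔_)
open import Relation.Binary.PropositionalEquality using (_≡_)

-- Edge e has endpoints (u , v) with toℕ u < toℕ v (no loops, fixed
-- orientation), and distinct edges have distinct endpoint pairs
-- (no multi-edges).

record SimpleGraph (n : ℕ) : Set where
  field
    m       : ℕ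
    ends    : Fin m → Fin n × Fin n
    ordered : (e : Fin m) → toℕ (proj₁ (ends e)) ℕ.< toℕ (proj₂ (ends e))
    simple  : Injective _≡_ _≡_ ends

open SimpleGraph public

record Subgraph {n : ℕ} (H : SimpleGraph n) : Set where
  field
    V'       : Subset n
    E'       : Subset (m H)
    closed   : (e : Fin (m H)) → e ∈ E' →
               (proj₁ (ends H e) ∈ V') × (proj₂ (ends H e) ∈ V')
    nonempty : NonZero ∣ V' ∣

open Subgraph public

ratio : {n : ℕ} {H : SimpleGraph n} → Subgraph H → ℚ
ratio S = (+ ∣ E' S ∣) / ∣ V' S ∣
  where instance _ = nonempty S

IsDensity : {n : ℕ} → SimpleGraph n → ℚ → Set
IsDensity H q =
  (Σ (Subgraph H) λ S → ratio S ≡ q) × ((S : Subgraph H) → ratio S ≤ q)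

-- A partition of the multigraph H^(b) (edge e of H with copies
-- j ∈ Fin b) into k parts: part i consists of the copies (e , j) with
-- colour e j ≡ i.

Colouring : {n : ℕ} → SimpleGraph n → ℕ → ℕ → Set
Colouring H b k = Fin (m H) → Fin b → Fin k

PartSimple : {n b k : ℕ} (H : SimpleGraph n) → Colouring H b k → Fin k → Set
PartSimple H c i = ∀ e j j' → c e j ≡ i → c e j' ≡ i → j ≡ j'

Adj : {n b k : ℕ} (H : SimpleGraph n) → Colouring H b k → Fin k →
      Fin n → Fin n → Set
Adj H c i u v = Σ (Fin (m H)) λ e → ∃ λ j → c e j ≡ i ×
                (ends H e ≡ (u , v) ⊎ ends H e ≡ (v , u))

module _ {n : ℕ} (R : Fin n → Fin n → Set) where

  Chain : List (Fin n) → Set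
  Chain []            = ⊤
  Chain (x ∷ [])      = ⊤
  Chain (x ∷ y ∷ xs)  = R x y × Chain (y ∷ xs)

  lastOf : Fin n → List (Fin n) → Fin n
  lastOf x []       = x
  lastOf x (y ∷ ys) = lastOf y ys

  Walk : Fin n → Fin n → Set
  Walk u v = Σ (List (Fin n)) λ xs → Chain (u ∷ xs) × lastOf u xs ≡ v

  Connected : Fin n → Fin n → Set
  Connected u v = Walk u v

  record Cycle : Set where
    field
      start : Fin n
      rest  : List (Fin n)
      long  : 2 ℕ.≤ length rest
      dist  : Unique (start ∷ rest)
      chain : Chain (start ∷ rest)
      close : R (lastOf start rest) start

  ConsecEdge : List (Fin n) → Fin n → Fin n → Set
  ConsecEdge []           u v = ⊥
  ConsecEdge (x ∷ [])     u v = ⊥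
  ConsecEdge (x ∷ y ∷ xs) u v =
    ((x ≡ u × y ≡ v) ⊎ (x ≡ v × y ≡ u)) ⊎ ConsecEdge (y ∷ xs) u v

  CycleEdge : Cycle → Fin n → Fin n → Set
  CycleEdge C u v =
    ConsecEdge (Cycle.start C ∷ Cycle.rest C) u v ⊎
    ((lastOf (Cycle.start C) (Cycle.rest C) ≡ u × Cycle.start C ≡ v) ⊎
     (lastOf (Cycle.start C) (Cycle.rest C) ≡ v × Cycle.start C ≡ u))

  -- cycles (as subgraphs, i.e. edge sets) are equal
  SameCycle : Cycle → Cycle → Set
  SameCycle C D = ∀ u v → CycleEdge C u v ⇔ CycleEdge D u v

  ComponentsUnicyclic : Set
  ComponentsUnicyclic = (C D : Cycle) →
    Connected (Cycle.start C) (Cycle.start D) → SameCycle C D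

module Submission where

-- By the definition of m(H), every set T of edges meets at least |T| / m(H) vertices, so
-- b |T| ≤ k |N(T)| for k = ⌈b m(H)⌉.  This is Hall's condition in Gale's supply–demand theorem,
-- which distributes load so that every edge hands b units to its two endpoints and every vertex
-- receives at most k (Hakimi's orientation argument).  As a vertex–edge bipartite multigraph the
-- loads have maximum degree k; padded to a k-regular square matrix they split into k perfect
-- matchings (Birkhoff–König).  An edge is matched, through one of its endpoints, in at least b of
-- them, and its b copies go to b distinct ones.  In each colour every vertex is matched to at most
-- one edge, so orienting edges away from their matched endpoint gives out-degree at most one, and a
-- graph of out-degree at most one has at most one cycle per component.

open import Defs
open import Data.Nat as ℕ using (ℕ)

module FiniteSums where

  open import Data.Nat
  open import Data.Nat.Properties
  open import Data.Fin using (Fin; zero; suc; splitAt)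
  open import Data.Product using (_,_; ∃)
  open import Data.Sum as Sum using (_⊎_; inj₁; inj₂)
  open import Function using (const)
  open import Relation.Nullary using (yes; no)
  open import Relation.Binary.PropositionalEquality
  open import Algebra.Properties.CommutativeMonoid.Sum +-0-commutativeMonoid public
    using (sum; sum-cong-≗; ∑-distrib-+; ∑-comm; sum-replicate-zero)

  private variable p : ℕ

  sum-mono-≤ : {f g : Fin p → ℕ} → (∀ i → f i ≤ g i) → sum f ≤ sum g
  sum-mono-≤ {zero}  f≤g = z≤n
  sum-mono-≤ {suc p} f≤g = +-mono-≤ (f≤g zero) (sum-mono-≤ (λ i → f≤g (suc i)))

  sum-const : ∀ c → sum {p} (const c) ≡ p * c
  sum-const {zero}  c = refl
  sum-const {suc p} c = cong (c +_) (sum-const {p} c)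

  term≤sum : ∀ (f : Fin p → ℕ) i → f i ≤ sum f
  term≤sum f zero    = m≤m+n (f zero) _
  term≤sum f (suc i) = ≤-trans (term≤sum (λ j → f (suc j)) i) (m≤n+m _ (f zero))

  sum>0⇒∃>0 : ∀ (f : Fin p → ℕ) → 0 < sum f → ∃ λ i → 0 < f i
  sum>0⇒∃>0 {suc p} f pos with f zero in eq
  ... | suc _ = zero , subst (0 <_) (sym eq) z<s
  ... | zero with sum>0⇒∃>0 (λ i → f (suc i)) pos
  ...   | i , fi>0 = suc i , fi>0

  sum≡0⇒≡0 : ∀ (f : Fin p → ℕ) → sum f ≡ 0 → ∀ i → f i ≡ 0
  sum≡0⇒≡0 f eq zero    = m+n≡0⇒m≡0 (f zero) eq
  sum≡0⇒≡0 f eq (suc i) = sum≡0⇒≡0 (λ j → f (suc j)) (m+n≡0⇒n≡0 (f zero) eq) i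

  sum<*⇒∃< : ∀ (f : Fin p → ℕ) c → sum f < p * c → ∃ λ i → f i < c
  sum<*⇒∃< {suc p} f c lt with f zero <? c
  ... | yes f0<c = zero , f0<c
  ... | no f0≮c with sum<*⇒∃< (λ i → f (suc i)) c
                       (+-cancelˡ-< c _ _ (≤-<-trans (+-monoˡ-≤ _ (≮⇒≥ f0≮c)) lt))
  ...   | i , fi<c = suc i , fi<c

  sum≤* : ∀ (f : Fin p → ℕ) c → (∀ i → f i ≤ c) → sum f ≤ p * c
  sum≤* {p} f c f≤c = ≤-trans (sum-mono-≤ f≤c) (≤-reflexive (sum-const {p} c))

  ∃<⇒sum<* : ∀ (f : Fin p → ℕ) c → (∀ i → f i ≤ c) → ∀ i → f i < c → sum f < p * c
  ∃<⇒sum<* f c f≤c zero    fi<c = +-mono-<-≤ fi<c (sum≤* _ c (λ j → f≤c (suc j)))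
  ∃<⇒sum<* f c f≤c (suc i) fi<c =
    +-mono-≤-< (f≤c zero) (∃<⇒sum<* (λ j → f (suc j)) c (λ j → f≤c (suc j)) i fi<c)

  sum≡*⇒≡ : ∀ (f : Fin p → ℕ) c → (∀ i → f i ≤ c) → sum f ≡ p * c → ∀ i → f i ≡ c
  sum≡*⇒≡ f c f≤c eq i =
    ≤-antisym (f≤c i) (≮⇒≥ (λ fi<c → <-irrefl eq (∃<⇒sum<* f c f≤c i fi<c)))

  sum-∸ : ∀ {f g : Fin p → ℕ} → (∀ i → g i ≤ f i) → sum (λ i → f i ∸ g i) + sum g ≡ sum f
  sum-∸ {f = f} {g} g≤f = trans (sym (∑-distrib-+ (λ i → f i ∸ g i) g)) (sum-cong-≗ (λ i → m∸n+n≡m (g≤f i)))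

  sum-splitAt : ∀ p {q} (g : Fin p ⊎ Fin q → ℕ) →
                sum (λ i → g (splitAt p i)) ≡ sum (λ i → g (inj₁ i)) + sum (λ j → g (inj₂ j))
  sum-splitAt zero    g = refl
  sum-splitAt (suc p) g = trans (cong (g (inj₁ zero) +_) (sum-splitAt p (λ s → g (Sum.map₁ suc s))))
                                (sym (+-assoc (g (inj₁ zero)) _ _))

module FiniteSets where

  open import Data.Nat hiding (_≟_)
  open import Data.Nat.Properties hiding (_≟_)
  open import Data.Fin using (Fin; zero; suc)
  import Data.Fin.Properties as Fin
  open import Data.Fin.Properties using (_≟_)
  open import Data.Bool using (Bool; true; false; if_then_else_; _∧_; _∨_; not)
  open import Data.Bool.Properties using (∧-comm; ∧-zeroʳ; ∧-identityʳ)
  open import Data.Product using (Σ; _×_; _,_; ∃)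
  open import Function.Definitions using (Injective)
  open import Function using (const)
  open import Relation.Nullary using (Dec; yes; no; does)
  open import Relation.Nullary.Decidable using (dec-true; dec-false)
  open import Data.Fin.Subset using (∣_∣) renaming (_∈_ to _∈ₛ_)
  open import Data.Vec using (tabulate)
  open import Data.Vec.Properties using (lookup∘tabulate; lookup⇒[]=; []=⇒lookup)
  open import Relation.Binary.PropositionalEquality
  open FiniteSums

  private variable p : ℕ

  FinSet : ℕ → Set
  FinSet p = Fin p → Bool

  infixr 7 _∩_
  infixr 6 _∪_
  infixr 10 ∑[_]_
  infix 4 _⊆_

  _∩_ : FinSet p → FinSet p → FinSet p
  (A ∩ B) i = A i ∧ B i

  _∪_ : FinSet p → FinSet p → FinSet p
  (A ∪ B) i = A i ∨ B i

  ∁ : FinSet p → FinSet p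
  ∁ A i = not (A i)

  ⁅_⁆ : Fin p → FinSet p
  ⁅ i ⁆ j = does (i ≟ j)

  _⊆_ : FinSet p → FinSet p → Set
  A ⊆ B = ∀ i → A i ≡ true → B i ≡ true

  does⇒ : ∀ {a} {A : Set a} (a? : Dec A) → does a? ≡ true → A
  does⇒ (yes a) _ = a

  ∈⁅⁆ : ∀ (i : Fin p) → ⁅ i ⁆ i ≡ true
  ∈⁅⁆ i = dec-true (i ≟ i) refl

  ∈⁅⁆⇒≡ : ∀ {i j : Fin p} → ⁅ i ⁆ j ≡ true → i ≡ j
  ∈⁅⁆⇒≡ {i = i} {j} = does⇒ (i ≟ j)

  ≢⇒∉⁅⁆ : ∀ {i j : Fin p} → i ≢ j → ⁅ i ⁆ j ≡ false
  ≢⇒∉⁅⁆ {i = i} {j} = dec-false (i ≟ j)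

  ∩-⊆ˡ : ∀ (A B : FinSet p) → A ∩ B ⊆ A
  ∩-⊆ˡ A B i AB with A i
  ... | true = refl

  ∩-⊆ʳ : ∀ (A B : FinSet p) → A ∩ B ⊆ B
  ∩-⊆ʳ A B i AB with A i
  ... | true = AB

  ⊆-∩ : ∀ {A B C : FinSet p} → A ⊆ B → A ⊆ C → A ⊆ B ∩ C
  ⊆-∩ A⊆B A⊆C i Ai rewrite A⊆B i Ai = A⊆C i Ai

  ⊆-antisym : ∀ {A B : FinSet p} → A ⊆ B → B ⊆ A → ∀ i → A i ≡ B i
  ⊆-antisym {A = A} {B} A⊆B B⊆A i with A i in Ai | B i in Bi
  ... | true  | true  = refl
  ... | false | false = refl
  ... | true  | false = trans (sym (A⊆B i Ai)) Bi
  ... | false | true  = trans (sym Ai) (B⊆A i Bi)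

  ∉⇒disjoint-⁅⁆ : ∀ {A : FinSet p} {i} → A i ≡ false → ∀ j → (A ∩ ⁅ i ⁆) j ≡ false
  ∉⇒disjoint-⁅⁆ {A = A} {i} Ai j with ⁅ i ⁆ j in j∈⁅i⁆
  ... | false = ∧-zeroʳ (A j)
  ... | true = trans (∧-identityʳ (A j)) (subst (λ k → A k ≡ false) (∈⁅⁆⇒≡ j∈⁅i⁆) Ai)

  restrict : FinSet p → (Fin p → ℕ) → Fin p → ℕ
  restrict A f i = if A i then f i else 0

  ∑[_]_ : FinSet p → (Fin p → ℕ) → ℕ
  ∑[ A ] f = sum (restrict A f)

  𝟙 : Bool → ℕ
  𝟙 b = if b then 1 else 0

  δ : Fin p → Fin p → ℕ
  δ i j = 𝟙 (⁅ i ⁆ j)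

  𝟙≤1 : ∀ b → 𝟙 b ≤ 1
  𝟙≤1 true  = ≤-refl
  𝟙≤1 false = z≤n

  δ≤ : ∀ (f : Fin p → ℕ) i → 0 < f i → ∀ j → δ i j ≤ f j
  δ≤ f i fi>0 j with i ≟ j
  ... | yes refl = fi>0
  ... | no  _    = z≤n

  restrict≤ : ∀ A (f : Fin p → ℕ) i → restrict A f i ≤ f i
  restrict≤ A f i with A i
  ... | true  = ≤-refl
  ... | false = z≤n

  ∑≤sum : ∀ A (f : Fin p → ℕ) → ∑[ A ] f ≤ sum f
  ∑≤sum A f = sum-mono-≤ (restrict≤ A f)

  ∑-mono-⊆ : ∀ {A B} (f : Fin p → ℕ) → A ⊆ B → ∑[ A ] f ≤ ∑[ B ] f
  ∑-mono-⊆ {A = A} {B} f A⊆B = sum-mono-≤ pointwise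
    where
    pointwise : ∀ i → restrict A f i ≤ restrict B f i
    pointwise i with A i in Ai
    ... | false = z≤n
    ... | true rewrite A⊆B i Ai = ≤-refl

  ∑-congˡ : ∀ {A B} (f : Fin p → ℕ) → (∀ i → A i ≡ B i) → ∑[ A ] f ≡ ∑[ B ] f
  ∑-congˡ f A≗B = sum-cong-≗ (λ i → cong (λ b → if b then f i else 0) (A≗B i))

  ∑-congʳ : ∀ A {f g : Fin p → ℕ} → (∀ i → f i ≡ g i) → ∑[ A ] f ≡ ∑[ A ] g
  ∑-congʳ A f≗g = sum-cong-≗ (λ i → cong (λ v → if A i then v else 0) (f≗g i))

  restrict-∁ : ∀ A (f : Fin p → ℕ) i → restrict A f i + restrict (∁ A) f i ≡ f i
  restrict-∁ A f i with A i
  ... | true  = +-identityʳ (f i)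
  ... | false = refl

  ∑-∁ : ∀ A (f : Fin p → ℕ) → ∑[ A ] f + ∑[ ∁ A ] f ≡ sum f
  ∑-∁ A f = trans (sym (∑-distrib-+ (restrict A f) (restrict (∁ A) f))) (sum-cong-≗ (restrict-∁ A f))

  ∑-∪-∩ : ∀ A B (f : Fin p → ℕ) → ∑[ A ∪ B ] f + ∑[ A ∩ B ] f ≡ ∑[ A ] f + ∑[ B ] f
  ∑-∪-∩ A B f = begin
    ∑[ A ∪ B ] f + ∑[ A ∩ B ] f                 ≡⟨ ∑-distrib-+ (restrict (A ∪ B) f) _ ⟨
    sum (λ i → restrict (A ∪ B) f i + restrict (A ∩ B) f i) ≡⟨ sum-cong-≗ pointwise ⟩
    sum (λ i → restrict A f i + restrict B f i) ≡⟨ ∑-distrib-+ (restrict A f) _ ⟩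
    ∑[ A ] f + ∑[ B ] f                         ∎
    where
    open ≡-Reasoning
    pointwise : ∀ i → restrict (A ∪ B) f i + restrict (A ∩ B) f i ≡ restrict A f i + restrict B f i
    pointwise i with A i | B i
    ... | true  | true  = refl
    ... | true  | false = refl
    ... | false | true  = +-identityʳ (f i)
    ... | false | false = refl

  ∑-∪-disjoint : ∀ A B (f : Fin p → ℕ) → (∀ i → (A ∩ B) i ≡ false) →
                 ∑[ A ∪ B ] f ≡ ∑[ A ] f + ∑[ B ] f
  ∑-∪-disjoint {p} A B f disjoint = begin
    ∑[ A ∪ B ] f                ≡⟨ +-identityʳ _ ⟨
    ∑[ A ∪ B ] f + 0            ≡⟨ cong (∑[ A ∪ B ] f +_) (trans (∑-congˡ f disjoint) (sum-replicate-zero p)) ⟨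
    ∑[ A ∪ B ] f + ∑[ A ∩ B ] f ≡⟨ ∑-∪-∩ A B f ⟩
    ∑[ A ] f + ∑[ B ] f         ∎
    where open ≡-Reasoning

  ∑-∪-∁ : ∀ A B (f : Fin p → ℕ) → ∑[ A ∪ B ] f ≡ ∑[ A ∩ ∁ B ] f + ∑[ B ] f
  ∑-∪-∁ A B f = trans (sum-cong-≗ pointwise) (∑-distrib-+ (restrict (A ∩ ∁ B) f) (restrict B f))
    where
    pointwise : ∀ i → restrict (A ∪ B) f i ≡ restrict (A ∩ ∁ B) f i + restrict B f i
    pointwise i with A i | B i
    ... | true  | true  = refl
    ... | true  | false = sym (+-identityʳ (f i))
    ... | false | true  = refl
    ... | false | false = refl

  ∑-restrict : ∀ A B (f : Fin p → ℕ) → ∑[ A ] restrict B f ≡ ∑[ A ∩ B ] f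
  ∑-restrict A B f = sum-cong-≗ pointwise
    where
    pointwise : ∀ i → restrict A (restrict B f) i ≡ restrict (A ∩ B) f i
    pointwise i with A i
    ... | true  = refl
    ... | false = refl

  ∑[]-distrib-+ : ∀ A (f g : Fin p → ℕ) → ∑[ A ] (λ i → f i + g i) ≡ ∑[ A ] f + ∑[ A ] g
  ∑[]-distrib-+ A f g = trans (sum-cong-≗ pointwise) (∑-distrib-+ (restrict A f) (restrict A g))
    where
    pointwise : ∀ i → restrict A (λ i → f i + g i) i ≡ restrict A f i + restrict A g i
    pointwise i with A i
    ... | true  = refl
    ... | false = refl

  ∑-⁅⁆ : ∀ (i : Fin p) f → ∑[ ⁅ i ⁆ ] f ≡ f i
  ∑-⁅⁆ {suc p} zero    f = trans (cong (f zero +_) (sum-replicate-zero p)) (+-identityʳ (f zero))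
  ∑-⁅⁆ {suc p} (suc i) f = ∑-⁅⁆ i (λ j → f (suc j))

  ∑-δ : ∀ A (i : Fin p) → ∑[ A ] δ i ≡ 𝟙 (A i)
  ∑-δ A i = begin
    ∑[ A ] δ i                      ≡⟨ ∑-restrict A ⁅ i ⁆ (const 1) ⟩
    ∑[ A ∩ ⁅ i ⁆ ] const 1          ≡⟨ ∑-congˡ (const 1) (λ j → ∧-comm (A j) (⁅ i ⁆ j)) ⟩
    ∑[ ⁅ i ⁆ ∩ A ] const 1          ≡⟨ ∑-restrict ⁅ i ⁆ A (const 1) ⟨
    ∑[ ⁅ i ⁆ ] restrict A (const 1) ≡⟨ ∑-⁅⁆ i (restrict A (const 1)) ⟩
    𝟙 (A i)                         ∎
    where open ≡-Reasoning

  ∑-const : ∀ {p} (A : FinSet p) c → ∑[ A ] const c ≡ ∑[ A ] const 1 * c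
  ∑-const {zero}  A c = refl
  ∑-const {suc p} A c with A zero
  ... | true  = cong (c +_) (∑-const (λ i → A (suc i)) c)
  ... | false = ∑-const (λ i → A (suc i)) c

  ∑-∸δ : ∀ A (f : Fin p → ℕ) i → 0 < f i →
         ∑[ A ] f ≡ ∑[ A ] (λ j → f j ∸ δ i j) + 𝟙 (A i)
  ∑-∸δ A f i fi>0 = begin
    ∑[ A ] f                                    ≡⟨ ∑-congʳ A (λ j → m∸n+n≡m (δ≤ f i fi>0 j)) ⟨
    ∑[ A ] (λ j → f j ∸ δ i j + δ i j)          ≡⟨ ∑[]-distrib-+ A (λ j → f j ∸ δ i j) (δ i) ⟩
    ∑[ A ] (λ j → f j ∸ δ i j) + ∑[ A ] δ i     ≡⟨ cong (∑[ A ] (λ j → f j ∸ δ i j) +_) (∑-δ A i) ⟩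
    ∑[ A ] (λ j → f j ∸ δ i j) + 𝟙 (A i)        ∎
    where open ≡-Reasoning

  ∑+∉≤sum : ∀ {A : FinSet p} {i} (f : Fin p → ℕ) → A i ≡ false → ∑[ A ] f + f i ≤ sum f
  ∑+∉≤sum {A = A} {i} f Ai = begin
    ∑[ A ] f + f i             ≡⟨ cong (∑[ A ] f +_) (∑-⁅⁆ i f) ⟨
    ∑[ A ] f + ∑[ ⁅ i ⁆ ] f    ≡⟨ ∑-∪-disjoint A ⁅ i ⁆ f (∉⇒disjoint-⁅⁆ {A = A} Ai) ⟨
    ∑[ A ∪ ⁅ i ⁆ ] f           ≤⟨ ∑≤sum (A ∪ ⁅ i ⁆) f ⟩
    sum f                      ∎
    where open ≤-Reasoning

  ∑-∪-⁅⁆ : ∀ (f : Fin p → ℕ) {a a′} → a ≢ a′ → ∑[ ⁅ a ⁆ ∪ ⁅ a′ ⁆ ] f ≡ ∑[ ⁅ a ⁆ ] f + ∑[ ⁅ a′ ⁆ ] f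
  ∑-∪-⁅⁆ f {a} a≢a′ = ∑-∪-disjoint ⁅ a ⁆ _ f (∉⇒disjoint-⁅⁆ {A = ⁅ a ⁆} (≢⇒∉⁅⁆ a≢a′))

  two≤sum : ∀ (f : Fin p → ℕ) {a a′} → a ≢ a′ → f a + f a′ ≤ sum f
  two≤sum f {a} {a′} a≢a′ = begin
    f a + f a′                  ≡⟨ cong₂ _+_ (∑-⁅⁆ a f) (∑-⁅⁆ a′ f) ⟨
    ∑[ ⁅ a ⁆ ] f + ∑[ ⁅ a′ ⁆ ] f ≡⟨ ∑-∪-⁅⁆ f a≢a′ ⟨
    ∑[ ⁅ a ⁆ ∪ ⁅ a′ ⁆ ] f         ≤⟨ ∑≤sum (⁅ a ⁆ ∪ ⁅ a′ ⁆) f ⟩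
    sum f                       ∎
    where open ≤-Reasoning

  sum≡two : ∀ (f : Fin p → ℕ) {a a′} → a ≢ a′ → (∀ x → x ≢ a → x ≢ a′ → f x ≡ 0) →
            sum f ≡ f a + f a′
  sum≡two f {a} {a′} a≢a′ vanishes = begin
    sum f                        ≡⟨ sum-cong-≗ on-pair ⟩
    ∑[ ⁅ a ⁆ ∪ ⁅ a′ ⁆ ] f         ≡⟨ ∑-∪-⁅⁆ f a≢a′ ⟩
    ∑[ ⁅ a ⁆ ] f + ∑[ ⁅ a′ ⁆ ] f ≡⟨ cong₂ _+_ (∑-⁅⁆ a f) (∑-⁅⁆ a′ f) ⟩
    f a + f a′                   ∎
    where
    open ≡-Reasoning
    on-pair : ∀ x → f x ≡ restrict (⁅ a ⁆ ∪ ⁅ a′ ⁆) f x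
    on-pair x with a ≟ x | a′ ≟ x
    ... | yes _   | _       = refl
    ... | no  _   | yes _   = refl
    ... | no  a≢x | no  a′≢x = vanishes x (λ x≡a → a≢x (sym x≡a)) (λ x≡a′ → a′≢x (sym x≡a′))

  ∑>0⇒∃∈ : ∀ A (f : Fin p → ℕ) → 0 < ∑[ A ] f → ∃ λ i → A i ≡ true
  ∑>0⇒∃∈ A f pos with sum>0⇒∃>0 (restrict A f) pos
  ... | i , pos′ with A i in Ai | pos′
  ...   | true | _ = i , Ai

  ∈⇒≤∑ : ∀ {A} (f : Fin p → ℕ) {i} → A i ≡ true → f i ≤ ∑[ A ] f
  ∈⇒≤∑ {A = A} f {i} Ai =
    subst (_≤ ∑[ A ] f) (cong (λ b → if b then f i else 0) Ai) (term≤sum (restrict A f) i)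

  matrixUnit : ∀ {q} → Fin p → Fin q → Fin p → Fin q → ℕ
  matrixUnit i j a b = restrict ⁅ i ⁆ (const (δ j b)) a

  matrixUnit-row : ∀ {q} (i : Fin p) (j : Fin q) a → sum (matrixUnit i j a) ≡ δ i a
  matrixUnit-row {q = q} i j a with ⁅ i ⁆ a
  ... | true  = ∑-⁅⁆ j (const 1)
  ... | false = sum-replicate-zero q

  matrixUnit-col : ∀ {q} (i : Fin p) (j : Fin q) b → sum (λ a → matrixUnit i j a b) ≡ δ j b
  matrixUnit-col i j b = ∑-⁅⁆ i (const (δ j b))

  choose : ∀ (A : FinSet p) b → b ≤ ∑[ A ] const 1 →
           Σ (Fin b → Fin p) λ g → (∀ j → A (g j) ≡ true) × Injective _≡_ _≡_ g
  choose {zero}  A zero    _ = (λ ()) , (λ ()) , λ {}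
  choose {suc p} A b b≤ with A zero in A0
  choose {suc p} A zero    b≤       | true = (λ ()) , (λ ()) , λ {}
  choose {suc p} A (suc b) (s≤s b≤) | true with choose (λ i → A (suc i)) b b≤
  ... | g , g∈ , g-inj = g′ , g′∈ , g′-inj
    where
    g′ : Fin (suc b) → Fin (suc p)
    g′ zero    = zero
    g′ (suc j) = suc (g j)
    g′∈ : ∀ j → A (g′ j) ≡ true
    g′∈ zero    = A0
    g′∈ (suc j) = g∈ j
    g′-inj : Injective _≡_ _≡_ g′
    g′-inj {zero}  {zero}  _  = refl
    g′-inj {suc i} {suc j} eq = cong suc (g-inj (Fin.suc-injective eq))
  choose {suc p} A b b≤ | false with choose (λ i → A (suc i)) b b≤
  ... | g , g∈ , g-inj = (λ j → suc (g j)) , g∈ , λ eq → g-inj (Fin.suc-injective eq)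

  ∣tabulate∣ : ∀ {p} (A : FinSet p) → ∣ tabulate A ∣ ≡ ∑[ A ] const 1
  ∣tabulate∣ {zero}  A = refl
  ∣tabulate∣ {suc p} A with A zero
  ... | true  = cong suc (∣tabulate∣ (λ i → A (suc i)))
  ... | false = ∣tabulate∣ (λ i → A (suc i))

  ∈tabulate : ∀ {p} {A : FinSet p} {x} → A x ≡ true → x ∈ₛ tabulate A
  ∈tabulate {A = A} {x} Ax = lookup⇒[]= x (tabulate A) (trans (lookup∘tabulate A x) Ax)

  ∈tabulate⁻ : ∀ {p} {A : FinSet p} {x} → x ∈ₛ tabulate A → A x ≡ true
  ∈tabulate⁻ {A = A} {x} x∈ = trans (sym (lookup∘tabulate A x)) ([]=⇒lookup x∈)

module SupplyDemand where

  open import Data.Nat hiding (_≟_)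
  open import Data.Nat.Properties hiding (_≟_)
  open import Data.Fin using (Fin)
  open import Data.Fin.Properties using (any?)
  open import Data.Fin.Subset.Properties using (anySubset?)
  open import Data.Bool using (Bool; true; false; _∨_)
  open import Data.Bool.Properties using (∨-zeroʳ) renaming (_≟_ to _≟ᵇ_)
  open import Data.Vec using (lookup; tabulate)
  open import Data.Vec.Properties using (lookup∘tabulate)
  open import Data.Product using (_×_; _,_; ∃)
  open import Function using (const)
  open import Relation.Nullary using (¬_; Dec; yes; no; does)
  open import Relation.Nullary.Decidable using (_×-dec_; dec-true)
  open import Relation.Binary.PropositionalEquality
  open FiniteSums
  open FiniteSets

  module _ {p q : ℕ} (R : Fin p → Fin q → Bool) where

    neighbour? : ∀ (T : FinSet p) y → Dec (∃ λ i → T i ≡ true × R i y ≡ true)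
    neighbour? T y = any? λ i → (T i ≟ᵇ true) ×-dec (R i y ≟ᵇ true)

    N : FinSet p → FinSet q
    N T y = does (neighbour? T y)

    N-intro : ∀ {T : FinSet p} {i y} → T i ≡ true → R i y ≡ true → N T y ≡ true
    N-intro {T} {i} {y} Ti Riy = dec-true (any? _) (i , Ti , Riy)

    N-elim : ∀ {T : FinSet p} {y} → N T y ≡ true → ∃ λ i → T i ≡ true × R i y ≡ true
    N-elim {T} {y} = does⇒ (neighbour? T y)

    N-mono : ∀ {A B : FinSet p} → A ⊆ B → N A ⊆ N B
    N-mono A⊆B y y∈NA with N-elim y∈NA
    ... | i , Ai , Riy = N-intro (A⊆B i Ai) Riy

    N-∩ : ∀ (A B : FinSet p) → N (A ∩ B) ⊆ N A ∩ N B
    N-∩ A B = ⊆-∩ (N-mono (∩-⊆ˡ A B)) (N-mono (∩-⊆ʳ A B))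

    N-∪ : ∀ (A B : FinSet p) → N (A ∪ B) ⊆ N A ∪ N B
    N-∪ A B y y∈N with N-elim y∈N
    ... | i , ABi , Riy with A i in Ai
    ...   | true  = cong (_∨ N B y) (N-intro Ai Riy)
    ...   | false = trans (cong (N A y ∨_) (N-intro ABi Riy)) (∨-zeroʳ (N A y))

    N-cong : ∀ {A B : FinSet p} → (∀ i → A i ≡ B i) → ∀ y → N A y ≡ N B y
    N-cong A≗B = ⊆-antisym (N-mono (λ i Ai → trans (sym (A≗B i)) Ai))
                           (N-mono (λ i Bi → trans (A≗B i) Bi))

    HallCondition : (Fin p → ℕ) → (Fin q → ℕ) → Set
    HallCondition d c = ∀ T → ∑[ T ] d ≤ ∑[ N T ] c

    record Transport (d : Fin p → ℕ) (c : Fin q → ℕ) : Set where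
      field
        flow     : Fin p → Fin q → ℕ
        supply   : ∀ i → sum (flow i) ≡ d i
        capacity : ∀ y → sum (λ i → flow i y) ≤ c y
        along-R  : ∀ i y → R i y ≡ false → flow i y ≡ 0

    open Transport

    transport-zero : ∀ {d c} → sum d ≡ 0 → Transport d c
    transport-zero {d} {c} sum≡0 = record
      { flow     = λ _ _ → 0
      ; supply   = λ i → trans (sum-replicate-zero q) (sym (sum≡0⇒≡0 d sum≡0 i))
      ; capacity = λ y → subst (_≤ c y) (sym (sum-replicate-zero p)) z≤n
      ; along-R  = λ _ _ _ → refl
      }

    transport-merge : ∀ {d₁ c₁ d₂ c₂ d c} → Transport d₁ c₁ → Transport d₂ c₂ →
                      (∀ i → d₁ i + d₂ i ≡ d i) → (∀ y → c₁ y + c₂ y ≤ c y) → Transport d c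
    transport-merge t₁ t₂ d₁+d₂≡d c₁+c₂≤c = record
      { flow     = λ i y → flow t₁ i y + flow t₂ i y
      ; supply   = λ i → trans (∑-distrib-+ (flow t₁ i) (flow t₂ i))
                               (trans (cong₂ _+_ (supply t₁ i) (supply t₂ i)) (d₁+d₂≡d i))
      ; capacity = λ y → ≤-trans (≤-reflexive (∑-distrib-+ (λ i → flow t₁ i y) (λ i → flow t₂ i y)))
                                 (≤-trans (+-mono-≤ (capacity t₁ y) (capacity t₂ y)) (c₁+c₂≤c y))
      ; along-R  = λ i y Riy → cong₂ _+_ (along-R t₁ i y Riy) (along-R t₂ i y Riy)
      }

    transport-unit : ∀ {i y} → R i y ≡ true → Transport (δ i) (δ y)
    transport-unit {i} {y} Riy = record
      { flow     = matrixUnit i y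
      ; supply   = matrixUnit-row i y
      ; capacity = λ z → ≤-reflexive (matrixUnit-col i y z)
      ; along-R  = off-R
      }
      where
      off-R : ∀ j z → R j z ≡ false → matrixUnit i y j z ≡ 0
      off-R j z Rjz with ⁅ i ⁆ j in j∈⁅i⁆ | ⁅ y ⁆ z in z∈⁅y⁆
      ... | false | _     = refl
      ... | true  | false = refl
      ... | true  | true  with trans (sym Riy) (subst₂ (λ a b → R a b ≡ false)
                                     (sym (∈⁅⁆⇒≡ {i = i} j∈⁅i⁆)) (sym (∈⁅⁆⇒≡ {i = y} z∈⁅y⁆)) Rjz)
      ...   | ()

    hall-outlet : ∀ {d c i} → HallCondition d c → 0 < d i → ∃ λ y → R i y ≡ true × 0 < c y
    hall-outlet {d} {c} {i} hall di>0
      with sum>0⇒∃>0 (restrict (N ⁅ i ⁆) c) (<-≤-trans di>0 (subst (_≤ _) (∑-⁅⁆ i d) (hall ⁅ i ⁆)))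
    ... | y , pos with N ⁅ i ⁆ y in y∈N | pos
    ...   | true | cy>0 with N-elim y∈N
    ...     | j , j∈⁅i⁆ , Rjy = y , subst (λ k → R k y ≡ true) (sym (∈⁅⁆⇒≡ j∈⁅i⁆)) Rjy , cy>0

    hall-inside : ∀ {d c} → HallCondition d c → ∀ T → HallCondition (restrict T d) (restrict (N T) c)
    hall-inside {d} {c} hall T T′ = begin
      ∑[ T′ ] restrict T d     ≡⟨ ∑-restrict T′ T d ⟩
      ∑[ T′ ∩ T ] d            ≤⟨ hall (T′ ∩ T) ⟩
      ∑[ N (T′ ∩ T) ] c        ≤⟨ ∑-mono-⊆ c (N-∩ T′ T) ⟩
      ∑[ N T′ ∩ N T ] c        ≡⟨ ∑-restrict (N T′) (N T) c ⟨
      ∑[ N T′ ] restrict (N T) c ∎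
      where open ≤-Reasoning

    hall-outside : ∀ {d c} → HallCondition d c → ∀ T → ∑[ N T ] c ≤ ∑[ T ] d →
                   HallCondition (restrict (∁ T) d) (restrict (∁ (N T)) c)
    hall-outside {d} {c} hall T tight T′ = begin
      ∑[ T′ ] restrict (∁ T) d     ≡⟨ ∑-restrict T′ (∁ T) d ⟩
      ∑[ A ] d                     ≤⟨ +-cancelʳ-≤ (∑[ T ] d) _ _ (≤-trans A∪T (+-monoʳ-≤ _ tight)) ⟩
      ∑[ N A ∩ ∁ (N T) ] c         ≤⟨ ∑-mono-⊆ c (⊆-∩ {B = N T′} {C = ∁ (N T)}
                                        (λ y y∈ → N-mono (∩-⊆ˡ T′ (∁ T)) y (∩-⊆ˡ (N A) (∁ (N T)) y y∈))
                                        (∩-⊆ʳ (N A) (∁ (N T)))) ⟩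
      ∑[ N T′ ∩ ∁ (N T) ] c        ≡⟨ ∑-restrict (N T′) (∁ (N T)) c ⟨
      ∑[ N T′ ] restrict (∁ (N T)) c ∎
      where
      open ≤-Reasoning
      A : FinSet p
      A = T′ ∩ ∁ T
      disjoint : ∀ j → (A ∩ T) j ≡ false
      disjoint j with T′ j | T j
      ... | true  | true  = refl
      ... | true  | false = refl
      ... | false | _     = refl
      A∪T : ∑[ A ] d + ∑[ T ] d ≤ ∑[ N A ∩ ∁ (N T) ] c + ∑[ N T ] c
      A∪T = begin
        ∑[ A ] d + ∑[ T ] d               ≡⟨ ∑-∪-disjoint A T d disjoint ⟨
        ∑[ A ∪ T ] d                      ≤⟨ hall (A ∪ T) ⟩
        ∑[ N (A ∪ T) ] c                  ≤⟨ ∑-mono-⊆ c (N-∪ A T) ⟩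
        ∑[ N A ∪ N T ] c                  ≡⟨ ∑-∪-∁ (N A) (N T) c ⟩
        ∑[ N A ∩ ∁ (N T) ] c + ∑[ N T ] c ∎

    Tight : (Fin p → ℕ) → (Fin q → ℕ) → Fin p → FinSet p → Set
    Tight d c i T = T i ≡ false × 0 < ∑[ T ] d × ∑[ N T ] c ≤ ∑[ T ] d

    tight? : ∀ d c i T → Dec (Tight d c i T)
    tight? d c i T = (T i ≟ᵇ false) ×-dec (0 <? ∑[ T ] d) ×-dec (∑[ N T ] c ≤? ∑[ T ] d)

    tight-cong : ∀ {d c i A B} → (∀ j → A j ≡ B j) → Tight d c i A → Tight d c i B
    tight-cong {d} {c} {i} A≗B (Ai , pos , le) =
      trans (sym (A≗B i)) Ai ,
      subst (0 <_) (∑-congˡ d A≗B) pos ,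
      subst₂ _≤_ (∑-congˡ c (N-cong A≗B)) (∑-congˡ d A≗B) le

    SmallerTransports : (Fin p → ℕ) → Set
    SmallerTransports d = ∀ d′ c′ → sum d′ < sum d → HallCondition d′ c′ → Transport d′ c′

    transport-split : ∀ {d c i T} → SmallerTransports d → HallCondition d c → 0 < d i →
                      Tight d c i T → Transport d c
    transport-split {d} {c} {i} {T} rec hall di>0 (Ti , pos , tight) =
      transport-merge (rec (restrict T d) (restrict (N T) c) inside< (hall-inside hall T))
                      (rec (restrict (∁ T) d) (restrict (∁ (N T)) c) outside< (hall-outside hall T tight))
                      (restrict-∁ T d) (λ y → ≤-reflexive (restrict-∁ (N T) c y))
      where
      inside< : ∑[ T ] d < sum d
      inside< = <-≤-trans (m<m+n _ di>0) (∑+∉≤sum d Ti)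
      outside< : ∑[ ∁ T ] d < sum d
      outside< = <-≤-trans (m<n+m _ pos) (≤-reflexive (∑-∁ T d))

    hall-decrement : ∀ {d c i y} → HallCondition d c → 0 < d i → 0 < c y →
                     (∀ T → ¬ Tight d c i T) →
                     HallCondition (λ j → d j ∸ δ i j) (λ z → c z ∸ δ y z)
    hall-decrement {d} {c} {i} {y} hall di>0 cy>0 ¬tight T =
      cancel (T i) (N T y) refl (subst₂ _≤_ dT cNT (hall T))
      where
      D C : ℕ
      D = ∑[ T ] (λ j → d j ∸ δ i j)
      C = ∑[ N T ] (λ z → c z ∸ δ y z)
      dT : ∑[ T ] d ≡ D + 𝟙 (T i)
      dT = ∑-∸δ T d i di>0
      cNT : ∑[ N T ] c ≡ C + 𝟙 (N T y)
      cNT = ∑-∸δ (N T) c y cy>0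
      cancel : ∀ a b → T i ≡ a → D + 𝟙 a ≤ C + 𝟙 b → D ≤ C
      cancel true  b     _  le = +-cancelʳ-≤ 1 D C (≤-trans le (+-monoʳ-≤ C (𝟙≤1 b)))
      cancel false false _  le = +-cancelʳ-≤ 0 D C le
      cancel false true  Ti _  = ≮⇒≥ λ C<D → ¬tight T (Ti , pos C<D , tight C<D)
        where
        dT₀ : ∑[ T ] d ≡ D
        dT₀ = trans (subst (λ a → ∑[ T ] d ≡ D + 𝟙 a) Ti dT) (+-identityʳ D)
        pos : C < D → 0 < ∑[ T ] d
        pos C<D = subst (0 <_) (sym dT₀) (≤-<-trans z≤n C<D)
        tight : C < D → ∑[ N T ] c ≤ ∑[ T ] d
        tight C<D = begin
          ∑[ N T ] c      ≡⟨ cNT ⟩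
          C + 𝟙 (N T y)   ≤⟨ +-monoʳ-≤ C (𝟙≤1 (N T y)) ⟩
          C + 1           ≡⟨ +-comm C 1 ⟩
          suc C           ≤⟨ C<D ⟩
          D               ≡⟨ dT₀ ⟨
          ∑[ T ] d        ∎
          where open ≤-Reasoning

    transport-decrement : ∀ {d c i} → SmallerTransports d → HallCondition d c → 0 < d i →
                          (∀ T → ¬ Tight d c i T) → Transport d c
    transport-decrement {d} {c} {i} rec hall di>0 ¬tight with hall-outlet hall di>0
    ... | y , Riy , cy>0 =
      transport-merge (rec d′ c′ smaller (hall-decrement hall di>0 cy>0 ¬tight)) (transport-unit Riy)
                      (λ j → m∸n+n≡m (δ≤ d i di>0 j)) (λ z → ≤-reflexive (m∸n+n≡m (δ≤ c y cy>0 z)))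
      where
      d′ : Fin p → ℕ
      d′ j = d j ∸ δ i j
      c′ : Fin q → ℕ
      c′ z = c z ∸ δ y z
      smaller : sum d′ < sum d
      smaller = subst (sum d′ <_) (sym (trans (∑-∸δ (const true) d i di>0) (+-comm (sum d′) 1))) ≤-refl

    -- Gale's induction: a tight set of sources avoiding i splits the problem into two smaller
    -- ones; if there is none, one unit can be sent from i to any admissible sink.
    transport-step : ∀ {d c} → SmallerTransports d → HallCondition d c → 0 < sum d → Transport d c
    transport-step {d} {c} rec hall pos with sum>0⇒∃>0 d pos
    ... | i , di>0 with anySubset? (λ T → tight? d c i (lookup T))
    ...   | yes (_ , tight) = transport-split rec hall di>0 tight
    ...   | no  ¬tight      = transport-decrement rec hall di>0 λ T tight →
                                ¬tight (tabulate T , tight-cong (λ j → sym (lookup∘tabulate T j)) tight)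

    transport-bounded : ∀ n d c → sum d ≤ n → HallCondition d c → Transport d c
    transport-bounded zero    d c bound hall = transport-zero (n≤0⇒n≡0 bound)
    transport-bounded (suc n) d c bound hall with 0 <? sum d
    ... | no  ¬pos = transport-zero (n≤0⇒n≡0 (≮⇒≥ ¬pos))
    ... | yes pos  = transport-step (λ d′ c′ lt → transport-bounded n d′ c′ (≤-pred (≤-trans lt bound))) hall pos

    transport : ∀ {d c} → HallCondition d c → Transport d c
    transport {d} {c} = transport-bounded (sum d) d c ≤-refl

module Birkhoff where

  open import Data.Nat hiding (_≟_)
  open import Data.Nat.Properties hiding (_≟_)
  open import Data.Fin using (Fin; zero; suc)
  open import Data.Fin.Properties using (_≟_)
  open import Data.Bool using (Bool; true; false)
  open import Data.Product using (_×_; _,_; ∃; proj₁; proj₂)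
  open import Data.Empty using (⊥-elim)
  open import Function using (const)
  open import Function.Definitions using (Injective)
  open import Relation.Nullary using (yes; no; does)
  open import Relation.Nullary.Decidable using (dec-true)
  open import Relation.Binary.PropositionalEquality
  open FiniteSums
  open FiniteSets
  open SupplyDemand

  private variable p k : ℕ

  Matrix : ℕ → Set
  Matrix p = Fin p → Fin p → ℕ

  column : Matrix p → Fin p → Fin p → ℕ
  column M j i = M i j

  total : Matrix p → ℕ
  total M = sum (λ i → sum (M i))

  record Bounded (k : ℕ) (M : Matrix p) : Set where
    field
      rows : ∀ i → sum (M i) ≤ k
      cols : ∀ j → sum (column M j) ≤ k

  record Regular (k : ℕ) (M : Matrix p) : Set where
    field
      rows : ∀ i → sum (M i) ≡ k
      cols : ∀ j → sum (column M j) ≡ k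

  total≤ : ∀ {M : Matrix p} → Bounded k M → total M ≤ p * k
  total≤ {k = k} {M} bounded = sum≤* (λ i → sum (M i)) k (Bounded.rows bounded)

  bounded-full⇒regular : ∀ {M : Matrix p} → Bounded k M → total M ≡ p * k → Regular k M
  bounded-full⇒regular {k = k} {M} bounded full = record
    { rows = sum≡*⇒≡ (λ i → sum (M i)) k (Bounded.rows bounded) full
    ; cols = sum≡*⇒≡ (λ j → sum (column M j)) k (Bounded.cols bounded) (trans (sym (∑-comm M)) full)
    }

  bump≤ : ∀ (f : Fin p → ℕ) {i} → (∀ a → f a ≤ k) → f i < k → ∀ a → f a + δ i a ≤ k
  bump≤ {k = k} f {i} f≤k fi<k a with i ≟ a
  ... | yes refl = subst (_≤ k) (+-comm 1 (f i)) fi<k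
  ... | no  _    = subst (_≤ k) (sym (+-identityʳ (f a))) (f≤k a)

  infixl 6 _+ᴹ_

  _+ᴹ_ : Matrix p → Matrix p → Matrix p
  (M +ᴹ N) i j = M i j + N i j

  add-unit : ∀ {M : Matrix p} {i j} → Bounded k M → sum (M i) < k → sum (column M j) < k →
             Bounded k (M +ᴹ matrixUnit i j)
  add-unit {k = k} {M} {i} {j} bounded row<k col<k = record
    { rows = λ a → subst (_≤ k) (sym (trans (∑-distrib-+ (M a) (matrixUnit i j a))
                                            (cong (sum (M a) +_) (matrixUnit-row i j a))))
                                (bump≤ (λ a → sum (M a)) (Bounded.rows bounded) row<k a)
    ; cols = λ b → subst (_≤ k) (sym (trans (∑-distrib-+ (column M b) (λ a → matrixUnit i j a b))
                                            (cong (sum (column M b) +_) (matrixUnit-col i j b))))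
                                (bump≤ (λ b → sum (column M b)) (Bounded.cols bounded) col<k b)
    }

  total-+unit : ∀ (M : Matrix p) i j → total (M +ᴹ matrixUnit i j) ≡ total M + 1
  total-+unit M i j = begin
    total (M +ᴹ matrixUnit i j)               ≡⟨ sum-cong-≗ (λ a → ∑-distrib-+ (M a) (matrixUnit i j a)) ⟩
    sum (λ a → sum (M a) + sum (matrixUnit i j a)) ≡⟨ sum-cong-≗ (λ a → cong (sum (M a) +_) (matrixUnit-row i j a)) ⟩
    sum (λ a → sum (M a) + δ i a)             ≡⟨ ∑-distrib-+ (λ a → sum (M a)) (δ i) ⟩
    total M + sum (δ i)                       ≡⟨ cong (total M +_) (∑-⁅⁆ i (const 1)) ⟩
    total M + 1                               ∎
    where open ≡-Reasoning

  record Padding (k : ℕ) (M : Matrix p) : Set where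
    field
      padded    : Matrix p
      dominates : ∀ i j → M i j ≤ padded i j
      regular   : Regular k padded

  padding-weaken : ∀ {M M′ : Matrix p} → (∀ i j → M i j ≤ M′ i j) → Padding k M′ → Padding k M
  padding-weaken M≤M′ P = record
    { padded    = Padding.padded P
    ; dominates = λ i j → ≤-trans (M≤M′ i j) (Padding.dominates P i j)
    ; regular   = Padding.regular P
    }

  pad-bounded : ∀ n {M : Matrix p} → p * k ≤ total M + n → Bounded k M → Padding k M
  pad-bounded {p} {k} n {M} fuel bounded with total M <? p * k
  ... | no ¬lt = record
    { padded    = M
    ; dominates = λ _ _ → ≤-refl
    ; regular   = bounded-full⇒regular bounded (≤-antisym (total≤ bounded) (≮⇒≥ ¬lt))
    }
  pad-bounded {p} {k} zero    {M} fuel bounded | yes lt = ⊥-elim (<⇒≱ lt (subst (_ ≤_) (+-identityʳ _) fuel))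
  pad-bounded {p} {k} (suc n) {M} fuel bounded | yes lt
    with sum<*⇒∃< (λ i → sum (M i)) k lt | sum<*⇒∃< (λ j → sum (column M j)) k (subst (_< p * k) (∑-comm M) lt)
  ... | i , row<k | j , col<k =
    padding-weaken (λ a b → m≤m+n (M a b) _) (pad-bounded n fuel′ (add-unit bounded row<k col<k))
    where
    fuel′ : p * k ≤ total (M +ᴹ matrixUnit i j) + n
    fuel′ = subst (p * k ≤_) (sym (trans (cong (_+ n) (total-+unit M i j)) (+-assoc (total M) 1 n))) fuel

  pad : ∀ {M : Matrix p} → Bounded k M → Padding k M
  pad {p} {k} {M} = pad-bounded (p * k) (m≤n+m (p * k) (total M))

  support : Matrix p → Fin p → Fin p → Bool
  support M i j = does (0 <? M i j)

  support⇒pos : ∀ {M : Matrix p} {i j} → support M i j ≡ true → 0 < M i j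
  support⇒pos {M = M} {i} {j} = does⇒ (0 <? M i j)

  pos⇒support : ∀ {M : Matrix p} {i j} → 0 < M i j → support M i j ≡ true
  pos⇒support {M = M} {i} {j} = dec-true (0 <? M i j)

  regular-hall : ∀ {M : Matrix p} → Regular (suc k) M → HallCondition (support M) (const 1) (const 1)
  regular-hall {p} {k} {M} regular T = *-cancelʳ-≤ (∑[ T ] const 1) (∑[ N (support M) T ] const 1) (suc k) (begin
    ∑[ T ] const 1 * suc k                          ≡⟨ ∑-const T (suc k) ⟨
    ∑[ T ] const (suc k)                            ≡⟨ ∑-congʳ T (λ i → sym (Regular.rows regular i)) ⟩
    ∑[ T ] (λ i → sum (M i))                        ≡⟨ sum-cong-≗ restrict-row ⟩
    sum (λ i → sum (λ j → restrict T (column M j) i)) ≡⟨ ∑-comm (λ i j → restrict T (column M j) i) ⟩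
    sum (λ j → ∑[ T ] column M j)                   ≤⟨ sum-mono-≤ column≤ ⟩
    ∑[ N (support M) T ] const (suc k)              ≡⟨ ∑-const (N (support M) T) (suc k) ⟩
    ∑[ N (support M) T ] const 1 * suc k            ∎)
    where
    open ≤-Reasoning
    restrict-row : ∀ i → restrict T (λ i → sum (M i)) i ≡ sum (λ j → restrict T (column M j) i)
    restrict-row i with T i
    ... | true  = refl
    ... | false = sym (sum-replicate-zero p)
    column≤ : ∀ j → ∑[ T ] column M j ≤ restrict (N (support M) T) (const (suc k)) j
    column≤ j with N (support M) T j in j∈NT
    ... | true  = ≤-trans (∑≤sum T (column M j)) (≤-reflexive (Regular.cols regular j))
    ... | false = ≤-reflexive (trans (sum-cong-≗ outside) (sum-replicate-zero p))
      where
      outside : ∀ i → restrict T (column M j) i ≡ 0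
      outside i with T i in Ti | M i j in Mij
      ... | false | _     = refl
      ... | true  | zero  = refl
      ... | true  | suc _ with trans (sym j∈NT) (N-intro (support M) {T} Ti (pos⇒support {M = M} (subst (0 <_) (sym Mij) z<s)))
      ...   | ()

  ColumnsAtMostOnce : (Fin p → Fin p) → Set
  ColumnsAtMostOnce {p} σ = ∀ j → sum (λ i → δ (σ i) j) ≤ 1

  matching : ∀ {R : Fin p → Fin p → Bool} → Transport R (const 1) (const 1) →
             ∃ λ σ → (∀ i → R i (σ i) ≡ true) × ColumnsAtMostOnce σ
  matching {R = R} t = σ , along , λ j → ≤-trans (sum-mono-≤ (λ i → δ≤ (flow i) (σ i) (chosen i) j)) (capacity j)
    where
    open Transport t
    choice : ∀ i → ∃ λ j → 0 < flow i j
    choice i = sum>0⇒∃>0 (flow i) (subst (0 <_) (sym (supply i)) z<s)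
    σ : Fin _ → Fin _
    σ i = proj₁ (choice i)
    chosen : ∀ i → 0 < flow i (σ i)
    chosen i = proj₂ (choice i)
    along : ∀ i → R i (σ i) ≡ true
    along i with R i (σ i) in Riσi
    ... | true  = refl
    ... | false = ⊥-elim (<-irrefl (sym (along-R i (σ i) Riσi)) (chosen i))

  columnsAtMostOnce⇒injective : ∀ {σ : Fin p → Fin p} → ColumnsAtMostOnce σ → Injective _≡_ _≡_ σ
  columnsAtMostOnce⇒injective {σ = σ} once {a} {a′} σa≡σa′ with a ≟ a′
  ... | yes a≡a′ = a≡a′
  ... | no  a≢a′ = ⊥-elim (<-irrefl refl (≤-trans two (once (σ a))))
    where
    two : 2 ≤ sum (λ i → δ (σ i) (σ a))
    two = subst (_≤ sum (λ i → δ (σ i) (σ a)))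
                (cong₂ (λ u v → 𝟙 u + 𝟙 v) (∈⁅⁆ (σ a)) (subst (λ x → ⁅ x ⁆ (σ a) ≡ true) σa≡σa′ (∈⁅⁆ (σ a))))
                (two≤sum (λ i → δ (σ i) (σ a)) a≢a′)

  columnsAtMostOnce⇒exactlyOnce : ∀ {σ : Fin p → Fin p} → ColumnsAtMostOnce σ →
                                  ∀ j → sum (λ i → δ (σ i) j) ≡ 1
  columnsAtMostOnce⇒exactlyOnce {p} {σ} once =
    sum≡*⇒≡ (λ j → sum (λ i → δ (σ i) j)) 1 once (begin
      sum (λ j → sum (λ i → δ (σ i) j)) ≡⟨ ∑-comm (λ i j → δ (σ i) j) ⟨
      sum (λ i → sum (δ (σ i)))          ≡⟨ sum-cong-≗ (λ i → ∑-⁅⁆ (σ i) (const 1)) ⟩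
      sum {p} (const 1)                  ≡⟨ sum-const {p} 1 ⟩
      p * 1                              ∎)
    where open ≡-Reasoning

  PerfectMatching : Matrix p → (Fin p → Fin p) → Set
  PerfectMatching M σ = (∀ i → 0 < M i (σ i)) × ColumnsAtMostOnce σ

  perfect-matching : ∀ {M : Matrix p} → Regular (suc k) M → ∃ (PerfectMatching M)
  perfect-matching {M = M} regular with matching (transport (support M) (regular-hall regular))
  ... | σ , along , once = σ , (λ i → support⇒pos {M = M} (along i)) , once

  _−ᴾ_ : Matrix p → (Fin p → Fin p) → Matrix p
  (M −ᴾ σ) i j = M i j ∸ δ (σ i) j

  remove-matching : ∀ {M : Matrix p} {σ} → Regular (suc k) M → PerfectMatching M σ → Regular k (M −ᴾ σ)
  remove-matching {k = k} {M} {σ} regular (pos , once) = record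
    { rows = λ i → +-cancelʳ-≡ 1 _ k (begin
        sum ((M −ᴾ σ) i) + 1              ≡⟨ cong (sum ((M −ᴾ σ) i) +_) (∑-⁅⁆ (σ i) (const 1)) ⟨
        sum ((M −ᴾ σ) i) + sum (δ (σ i))  ≡⟨ sum-∸ (δ≤ (M i) (σ i) (pos i)) ⟩
        sum (M i)                         ≡⟨ Regular.rows regular i ⟩
        suc k                             ≡⟨ +-comm 1 k ⟩
        k + 1                             ∎)
    ; cols = λ j → +-cancelʳ-≡ 1 _ k (begin
        sum (column (M −ᴾ σ) j) + 1                       ≡⟨ cong (sum (column (M −ᴾ σ) j) +_)
                                                               (columnsAtMostOnce⇒exactlyOnce {σ = σ} once j) ⟨
        sum (column (M −ᴾ σ) j) + sum (λ i → δ (σ i) j)   ≡⟨ sum-∸ (λ i → δ≤ (M i) (σ i) (pos i) j) ⟩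
        sum (column M j)                                  ≡⟨ Regular.cols regular j ⟩
        suc k                                             ≡⟨ +-comm 1 k ⟩
        k + 1                                             ∎)
    }
    where open ≡-Reasoning

  record Decomposition (k : ℕ) (M : Matrix p) : Set where
    field
      σ            : Fin k → Fin p → Fin p
      injective    : ∀ c → Injective _≡_ _≡_ (σ c)
      multiplicity : ∀ i j → sum (λ c → δ (σ c i) j) ≡ M i j

  decompose : ∀ k {M : Matrix p} → Regular k M → Decomposition k M
  decompose zero {M} regular = record
    { σ            = λ ()
    ; injective    = λ ()
    ; multiplicity = λ i j → sym (sum≡0⇒≡0 (M i) (Regular.rows regular i) j)
    }
  decompose (suc k) {M} regular with perfect-matching regular
  ... | σ₀ , matched@(pos , once) = record
    { σ            = σ
    ; injective    = injective
    ; multiplicity = multiplicity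
    }
    where
    rest : Decomposition k (M −ᴾ σ₀)
    rest = decompose k (remove-matching regular matched)
    open Decomposition rest using () renaming (σ to σ′; injective to injective′; multiplicity to multiplicity′)
    σ : Fin (suc k) → Fin _ → Fin _
    σ zero    = σ₀
    σ (suc c) = σ′ c
    injective : ∀ c → Injective _≡_ _≡_ (σ c)
    injective zero    = columnsAtMostOnce⇒injective {σ = σ₀} once
    injective (suc c) = injective′ c
    multiplicity : ∀ i j → sum (λ c → δ (σ c i) j) ≡ M i j
    multiplicity i j = trans (cong (δ (σ₀ i) j +_) (multiplicity′ i j))
                             (trans (+-comm (δ (σ₀ i) j) _) (m∸n+n≡m (δ≤ (M i) (σ₀ i) (pos i) j)))

module FunctionalGraphs where

  open import Data.Nat using (ℕ; zero; suc; s≤s)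
  open import Data.Fin using (Fin)
  open import Data.List using (List; []; _∷_)
  open import Data.List.Relation.Unary.Any using (here; there)
  open import Data.List.Relation.Unary.All as All using (All; []; _∷_)
  open import Data.List.Relation.Unary.AllPairs using (_∷_)
  open import Data.List.Relation.Unary.Unique.Propositional using (Unique)
  open import Data.List.Membership.Propositional using (_∈_)
  open import Data.Maybe using (Maybe; just; _>>=_)
  open import Data.Maybe.Properties using (just-injective)
  open import Data.Product using (Σ; ∃; _×_; _,_; proj₁; proj₂)
  open import Data.Sum using (_⊎_; inj₁; inj₂)
  open import Data.Empty using (⊥-elim)
  open import Data.Unit using (⊤; tt)
  open import Function.Bundles using (mk⇔)
  open import Relation.Binary.PropositionalEquality

  -- Every R-edge joins some x to out x.  A cycle therefore runs along out in one direction and is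
  -- closed under out, and iterating out from any vertex joined to it by a walk lands on it.  So
  -- two connected cycles meet, and, both being closed under out, have the same vertices and edges.
  module _ {n : ℕ} (R : Fin n → Fin n → Set) (out : Fin n → Maybe (Fin n))
           (along-out : ∀ u v → R u v → out u ≡ just v ⊎ out v ≡ just u) where

    private
      Vertices : Set
      Vertices = List (Fin n)

    headOr : Fin n → Vertices → Fin n
    headOr w []      = w
    headOr w (b ∷ _) = b

    Forward : Fin n → Vertices → Set
    Forward w []      = ⊤
    Forward w (a ∷ r) = out a ≡ just (headOr w r) × Forward w r

    Backward : Fin n → Vertices → Set
    Backward w []      = ⊤
    Backward w (a ∷ r) = out a ≡ just w × Backward a r

    lastOf-∈ : ∀ a r → lastOf R a r ∈ (a ∷ r)
    lastOf-∈ a []      = here refl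
    lastOf-∈ a (b ∷ r) = there (lastOf-∈ b r)

    forward : ∀ a r w → Chain R (a ∷ r) → Unique (w ∷ a ∷ r) → out (lastOf R a r) ≡ just w →
              Forward w (a ∷ r)
    forward a []       w _          _ last = last , tt
    forward a (b ∷ r′) w (Rab , ch) ((w≢a ∷ w≢b) ∷ (a≢b ∷ a∉r) ∷ uniq) last
      with forward b r′ w ch (w≢b ∷ uniq) last
    ... | ob , rest with along-out a b Rab
    ...   | inj₁ oa  = oa , ob , rest
    ...   | inj₂ ob′ = ⊥-elim (next≢a r′ a∉r (just-injective (trans (sym ob) ob′)))
      where
      next≢a : ∀ r′ → All (a ≢_) r′ → headOr w r′ ≢ a
      next≢a []      _           = w≢a
      next≢a (c ∷ _) (a≢c ∷ _) c≡a = a≢c (sym c≡a)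

    backward : ∀ a r w → Chain R (a ∷ r) → Unique (a ∷ r) → out a ≡ just w →
               headOr a r ≢ w ⊎ r ≡ [] → Backward w (a ∷ r)
    backward a []       w _          _ oa _ = oa , tt
    backward a (b ∷ r′) w (Rab , ch) ((a≢b ∷ a∉r) ∷ uniq) oa b≢w with along-out a b Rab
    ... | inj₁ oa′ = ⊥-elim (b≢w′ b≢w (just-injective (trans (sym oa′) oa)))
      where
      b≢w′ : b ≢ w ⊎ (b ∷ r′) ≡ [] → b ≢ w
      b≢w′ (inj₁ b≢w) = b≢w
    ... | inj₂ ob = oa , backward b r′ a ch uniq ob (next≢a r′ a∉r)
      where
      next≢a : ∀ r′ → All (a ≢_) r′ → headOr b r′ ≢ a ⊎ r′ ≡ []
      next≢a []      _         = inj₂ refl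
      next≢a (c ∷ _) (a≢c ∷ _) = inj₁ (λ c≡a → a≢c (sym c≡a))

    Oriented : Cycle R → Set
    Oriented C = Forward (Cycle.start C) (Cycle.start C ∷ Cycle.rest C) ⊎
                 Backward (lastOf R (Cycle.start C) (Cycle.rest C)) (Cycle.start C ∷ Cycle.rest C)

    cycle-orientation : ∀ C → Oriented C
    cycle-orientation record { rest = [] ; long = () }
    cycle-orientation record { rest = _ ∷ [] ; long = s≤s () }
    cycle-orientation record { start = s ; rest = x₁ ∷ x₂ ∷ r ; dist = dist@((_ ∷ s≢x₂ ∷ _) ∷ x₁∉ ∷ _)
                       ; chain = Rsx₁ , ch ; close = close }
      with along-out (lastOf R x₂ r) s close
    ... | inj₁ out-last = inj₁ (out-s , rest)
      where
      rest : Forward s (x₁ ∷ x₂ ∷ r)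
      rest = forward x₁ (x₂ ∷ r) s ch dist out-last
      out-s : out s ≡ just x₁
      out-s with along-out s x₁ Rsx₁
      ... | inj₁ os = os
      ... | inj₂ ox₁ = ⊥-elim (s≢x₂ (just-injective (trans (sym ox₁) (proj₁ rest))))
    ... | inj₂ out-s = inj₂ (backward s (x₁ ∷ x₂ ∷ r) (lastOf R x₂ r) (Rsx₁ , ch) dist out-s
                                      (inj₁ (All.lookup x₁∉ (lastOf-∈ x₂ r))))

    OutEdgeFrom : Vertices → Fin n → Fin n → Set
    OutEdgeFrom xs u v = (u ∈ xs × out u ≡ just v) ⊎ (v ∈ xs × out v ≡ just u)

    outEdgeFrom-∷ : ∀ {a xs u v} → OutEdgeFrom xs u v → OutEdgeFrom (a ∷ xs) u v
    outEdgeFrom-∷ (inj₁ (u∈ , o)) = inj₁ (there u∈ , o)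
    outEdgeFrom-∷ (inj₂ (v∈ , o)) = inj₂ (there v∈ , o)

    outEdgeFrom-⊆ : ∀ {xs ys} → (∀ {x} → x ∈ xs → x ∈ ys) → ∀ {u v} → OutEdgeFrom xs u v → OutEdgeFrom ys u v
    outEdgeFrom-⊆ xs⊆ys (inj₁ (u∈ , o)) = inj₁ (xs⊆ys u∈ , o)
    outEdgeFrom-⊆ xs⊆ys (inj₂ (v∈ , o)) = inj₂ (xs⊆ys v∈ , o)

    consecEdge-sym : ∀ xs {u v} → ConsecEdge R xs u v → ConsecEdge R xs v u
    consecEdge-sym (a ∷ b ∷ r) (inj₁ (inj₁ ends)) = inj₁ (inj₂ ends)
    consecEdge-sym (a ∷ b ∷ r) (inj₁ (inj₂ ends)) = inj₁ (inj₁ ends)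
    consecEdge-sym (a ∷ b ∷ r) (inj₂ e)           = inj₂ (consecEdge-sym (b ∷ r) e)

    consecEdge-∈ : ∀ xs {u v} → ConsecEdge R xs u v → u ∈ xs × v ∈ xs
    consecEdge-∈ (a ∷ b ∷ r) (inj₁ (inj₁ (refl , refl))) = here refl , there (here refl)
    consecEdge-∈ (a ∷ b ∷ r) (inj₁ (inj₂ (refl , refl))) = there (here refl) , here refl
    consecEdge-∈ (a ∷ b ∷ r) (inj₂ e) with consecEdge-∈ (b ∷ r) e
    ... | u∈ , v∈ = there u∈ , there v∈

    forward-consecEdge : ∀ w xs {u v} → Forward w xs → ConsecEdge R xs u v → OutEdgeFrom xs u v
    forward-consecEdge w (a ∷ b ∷ r) (oa , _)    (inj₁ (inj₁ (refl , refl))) = inj₁ (here refl , oa)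
    forward-consecEdge w (a ∷ b ∷ r) (oa , _)    (inj₁ (inj₂ (refl , refl))) = inj₂ (here refl , oa)
    forward-consecEdge w (a ∷ b ∷ r) (_ , rest) (inj₂ e) = outEdgeFrom-∷ (forward-consecEdge w (b ∷ r) rest e)

    backward-consecEdge : ∀ w xs {u v} → Backward w xs → ConsecEdge R xs u v → OutEdgeFrom xs u v
    backward-consecEdge w (a ∷ b ∷ r) (_ , ob , _)    (inj₁ (inj₁ (refl , refl))) = inj₂ (there (here refl) , ob)
    backward-consecEdge w (a ∷ b ∷ r) (_ , ob , _)    (inj₁ (inj₂ (refl , refl))) = inj₁ (there (here refl) , ob)
    backward-consecEdge w (a ∷ b ∷ r) (_ , ob , rest) (inj₂ e) =
      outEdgeFrom-∷ (backward-consecEdge a (b ∷ r) (ob , rest) e)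

    forward-last : ∀ w a r → Forward w (a ∷ r) → out (lastOf R a r) ≡ just w
    forward-last w a []      (oa , _)   = oa
    forward-last w a (b ∷ r) (_ , rest) = forward-last w b r rest

    forward-outEdge : ∀ w a r {u v} → Forward w (a ∷ r) → u ∈ (a ∷ r) → out u ≡ just v →
                      ConsecEdge R (a ∷ r) u v ⊎ (lastOf R a r ≡ u × w ≡ v)
    forward-outEdge w a []      (oa , _) (here refl) ou = inj₂ (refl , just-injective (trans (sym oa) ou))
    forward-outEdge w a (b ∷ r) (oa , _) (here refl) ou = inj₁ (inj₁ (inj₁ (refl , just-injective (trans (sym oa) ou))))
    forward-outEdge w a (b ∷ r) (_ , rest) (there u∈) ou with forward-outEdge w b r rest u∈ ou
    ... | inj₁ e    = inj₁ (inj₂ e)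
    ... | inj₂ ends = inj₂ ends

    backward-outEdge : ∀ w a r {u v} → Backward w (a ∷ r) → u ∈ (a ∷ r) → out u ≡ just v →
                       (a ≡ u × w ≡ v) ⊎ ConsecEdge R (a ∷ r) v u
    backward-outEdge w a r (oa , _) (here refl) ou = inj₁ (refl , just-injective (trans (sym oa) ou))
    backward-outEdge w a (b ∷ r) (_ , rest) (there u∈) ou with backward-outEdge a b r rest u∈ ou
    ... | inj₁ (b≡u , a≡v) = inj₂ (inj₁ (inj₁ (a≡v , b≡u)))
    ... | inj₂ e           = inj₂ (inj₂ e)

    vertices : Cycle R → Vertices
    vertices C = Cycle.start C ∷ Cycle.rest C

    module _ (C : Cycle R) where

      private
        s : Fin n
        s = Cycle.start C
        r : Vertices
        r = Cycle.rest C
        last : Fin n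
        last = lastOf R s r

      cycleEdge⇒outEdge : ∀ {u v} → CycleEdge R C u v → OutEdgeFrom (vertices C) u v
      cycleEdge⇒outEdge e with cycle-orientation C | e
      ... | inj₁ fw | inj₁ e′                    = forward-consecEdge s (s ∷ r) fw e′
      ... | inj₁ fw | inj₂ (inj₁ (refl , refl)) = inj₁ (lastOf-∈ s r , forward-last s s r fw)
      ... | inj₁ fw | inj₂ (inj₂ (refl , refl)) = inj₂ (lastOf-∈ s r , forward-last s s r fw)
      ... | inj₂ bw | inj₁ e′                    = backward-consecEdge last (s ∷ r) bw e′
      ... | inj₂ bw | inj₂ (inj₁ (refl , refl)) = inj₂ (here refl , proj₁ bw)
      ... | inj₂ bw | inj₂ (inj₂ (refl , refl)) = inj₁ (here refl , proj₁ bw)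

      outEdge⇒cycleEdge : ∀ {u v} → OutEdgeFrom (vertices C) u v → CycleEdge R C u v
      outEdge⇒cycleEdge e with cycle-orientation C | e
      ... | inj₁ fw | inj₁ (u∈ , o) with forward-outEdge s s r fw u∈ o
      ...   | inj₁ e′   = inj₁ e′
      ...   | inj₂ ends = inj₂ (inj₁ ends)
      outEdge⇒cycleEdge e | inj₁ fw | inj₂ (v∈ , o) with forward-outEdge s s r fw v∈ o
      ...   | inj₁ e′   = inj₁ (consecEdge-sym (s ∷ r) e′)
      ...   | inj₂ ends = inj₂ (inj₂ ends)
      outEdge⇒cycleEdge e | inj₂ bw | inj₁ (u∈ , o) with backward-outEdge last s r bw u∈ o
      ...   | inj₁ (s≡u , last≡v) = inj₂ (inj₂ (last≡v , s≡u))
      ...   | inj₂ e′             = inj₁ (consecEdge-sym (s ∷ r) e′)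
      outEdge⇒cycleEdge e | inj₂ bw | inj₂ (v∈ , o) with backward-outEdge last s r bw v∈ o
      ...   | inj₁ (s≡v , last≡u) = inj₂ (inj₁ (last≡u , s≡v))
      ...   | inj₂ e′             = inj₁ e′

      out-closed : ∀ {x y} → x ∈ vertices C → out x ≡ just y → y ∈ vertices C
      out-closed x∈ o with cycle-orientation C
      ... | inj₁ fw with forward-outEdge s s r fw x∈ o
      ...   | inj₁ e        = proj₂ (consecEdge-∈ (s ∷ r) e)
      ...   | inj₂ (_ , refl) = here refl
      out-closed x∈ o | inj₂ bw with backward-outEdge last s r bw x∈ o
      ...   | inj₁ (_ , refl) = lastOf-∈ s r
      ...   | inj₂ e        = proj₁ (consecEdge-∈ (s ∷ r) e)

      module _ (S : Fin n → Set) (S-closed : ∀ {x y} → S x → out x ≡ just y → S y) where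

        forward-reaches-end : ∀ w a r′ {u} → Forward w (a ∷ r′) → u ∈ (a ∷ r′) → S u → S w
        forward-reaches-end w a []       (oa , _)    (here refl) Su = S-closed Su oa
        forward-reaches-end w a (b ∷ r′) (oa , rest) (here refl) Su =
          forward-reaches-end w b r′ rest (here refl) (S-closed Su oa)
        forward-reaches-end w a (b ∷ r′) (_ , rest)  (there u∈)  Su = forward-reaches-end w b r′ rest u∈ Su

        forward-all : ∀ w a r′ → Forward w (a ∷ r′) → S a → All S (a ∷ r′)
        forward-all w a []       _           Sa = Sa ∷ []
        forward-all w a (b ∷ r′) (oa , rest) Sa = Sa ∷ forward-all w b r′ rest (S-closed Sa oa)

        backward-reaches-start : ∀ w a r′ {u} → Backward w (a ∷ r′) → u ∈ (a ∷ r′) → S u → S a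
        backward-reaches-start w a r′       _             (here refl) Su = Su
        backward-reaches-start w a (b ∷ r′) (_ , ob , rest) (there u∈) Su =
          S-closed (backward-reaches-start a b r′ (ob , rest) u∈ Su) ob

        backward-all : ∀ w a r′ → Backward w (a ∷ r′) → S (lastOf R a r′) → All S (a ∷ r′)
        backward-all w a []       _               Slast = Slast ∷ []
        backward-all w a (b ∷ r′) (_ , ob , rest) Slast with backward-all a b r′ (ob , rest) Slast
        ... | Sb ∷ Srest = S-closed Sb ob ∷ Sb ∷ Srest

        closed-meets⇒contains : ∀ {z} → z ∈ vertices C → S z → All S (vertices C)
        closed-meets⇒contains z∈ Sz with cycle-orientation C
        ... | inj₁ fw = forward-all s s r fw (forward-reaches-end s s r fw z∈ Sz)
        ... | inj₂ bw = backward-all last s r bw (S-closed (backward-reaches-start last s r bw z∈ Sz) (proj₁ bw))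

    iterate : ℕ → Fin n → Maybe (Fin n)
    iterate zero    x = just x
    iterate (suc t) x = out x >>= iterate t

    iterate-step : ∀ t {x y} → out x ≡ just y → iterate (suc t) x ≡ iterate t y
    iterate-step t ox rewrite ox = refl

    ReachesCycle : Cycle R → Fin n → Set
    ReachesCycle C x = Σ ℕ λ t → Σ (Fin n) λ z → iterate t x ≡ just z × z ∈ vertices C

    reachesCycle-step : ∀ C {a b} → R a b → ReachesCycle C a → ReachesCycle C b
    reachesCycle-step C {a} {b} Rab (t , z , it , z∈) with along-out a b Rab
    ... | inj₂ ob = suc t , z , trans (iterate-step t ob) it , z∈
    reachesCycle-step C Rab (zero  , z , refl , z∈) | inj₁ oa = zero , _ , refl , out-closed C z∈ oa
    reachesCycle-step C Rab (suc t , z , it , z∈)   | inj₁ oa = t , z , trans (sym (iterate-step t oa)) it , z∈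

    reachesCycle-walk : ∀ C u xs → Chain R (u ∷ xs) → ReachesCycle C u → ReachesCycle C (lastOf R u xs)
    reachesCycle-walk C u []       _          reach = reach
    reachesCycle-walk C u (b ∷ xs) (Rub , ch) reach = reachesCycle-walk C b xs ch (reachesCycle-step C Rub reach)

    iterate-closed : ∀ D t {x z} → x ∈ vertices D → iterate t x ≡ just z → z ∈ vertices D
    iterate-closed D zero    x∈ refl = x∈
    iterate-closed D (suc t) {x} x∈ it with out x in ox
    ... | just y = iterate-closed D t (out-closed D x∈ ox) it

    connected⇒meet : ∀ C D → Connected R (Cycle.start C) (Cycle.start D) →
                     ∃ λ z → z ∈ vertices C × z ∈ vertices D
    connected⇒meet C D (xs , ch , end)
      with reachesCycle-walk C (Cycle.start C) xs ch (zero , Cycle.start C , refl , here refl)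
    ... | t , z , it , z∈C = z , z∈C , iterate-closed D t (subst (_∈ vertices D) (sym end) (here refl)) it

    meet⇒⊆ : ∀ C D {z} → z ∈ vertices C → z ∈ vertices D → ∀ {x} → x ∈ vertices C → x ∈ vertices D
    meet⇒⊆ C D z∈C z∈D = All.lookup (closed-meets⇒contains C (_∈ vertices D) (out-closed D) z∈C z∈D)

    functional⇒unicyclic : ComponentsUnicyclic R
    functional⇒unicyclic C D conn u v with connected⇒meet C D conn
    ... | z , z∈C , z∈D = mk⇔
      (λ e → outEdge⇒cycleEdge D (outEdgeFrom-⊆ (meet⇒⊆ C D z∈C z∈D) (cycleEdge⇒outEdge C e)))
      (λ e → outEdge⇒cycleEdge C (outEdgeFrom-⊆ (meet⇒⊆ D C z∈D z∈C) (cycleEdge⇒outEdge D e)))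

module CeilingArithmetic where

  open import Data.Nat as ℕ using (ℕ; suc; NonZero)
  import Data.Nat.Properties as ℕ
  open import Data.Integer as ℤ using (ℤ; +_; +[1+_]; -[1+_]; +≤+)
  import Data.Integer.Properties as ℤ
  open import Data.Integer.DivMod using ([n/d]*d≤n)
  open import Data.Rational using (module ℚ; ℚ; mkℚ; toℚᵘ; _/_; _*_; _≤_; ↥_; ↧_; -_; floor; ceiling)
  open import Data.Rational.Properties
    using (↥-neg; ↧-neg; toℚᵘ-fromℚᵘ; toℚᵘ-mono-≤; toℚᵘ-homo-*; ↥ᵘ-toℚᵘ; ↧ᵘ-toℚᵘ)
  import Data.Rational.Unnormalised as ℚᵘ
  import Data.Rational.Unnormalised.Properties as ℚᵘ
  open import Relation.Binary.PropositionalEquality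
  open import Data.Integer.Tactic.RingSolver using (solve-∀)

  -- Negation on ℚ computes by cases on the numerator, so floor (- r) only unfolds after the split.
  floor-neg : ∀ r → floor (- r) ≡ ↥ (- r) ℤ./ ↧ (- r)
  floor-neg (mkℚ (+ 0)      _ _) = refl
  floor-neg (mkℚ +[1+ _ ]   _ _) = refl
  floor-neg (mkℚ -[1+ _ ]   _ _) = refl

  ↥≤ceiling*↧ : ∀ r → ↥ r ℤ.≤ ⌈ r ⌉ ℤ.* ↧ r
  ↥≤ceiling*↧ r@record{} = begin
    ↥ r                                  ≡⟨ ℤ.neg-involutive (↥ r) ⟨
    ℤ.- (ℤ.- ↥ r)                        ≡⟨ cong ℤ.-_ (↥-neg r) ⟨
    ℤ.- ↥ (- r)                          ≤⟨ ℤ.neg-mono-≤ ([n/d]*d≤n (↥ (- r)) (↧ (- r))) ⟩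
    ℤ.- (↥ (- r) ℤ./ ↧ (- r) ℤ.* ↧ (- r)) ≡⟨ cong (λ x → ℤ.- (x ℤ.* ↧ (- r))) (floor-neg r) ⟨
    ℤ.- (floor (- r) ℤ.* ↧ (- r))        ≡⟨ ℤ.neg-distribˡ-* (floor (- r)) (↧ (- r)) ⟩
    ⌈ r ⌉ ℤ.* ↧ (- r)                    ≡⟨ cong (⌈ r ⌉ ℤ.*_) (↧-neg r) ⟩
    ⌈ r ⌉ ℤ.* ↧ r                        ∎
    where open ℤ.≤-Reasoning

  cross-multiply : ∀ {b t k N Qd Rd : ℕ} {Qn Rn : ℤ} →
                   + t ℤ.* + suc Qd ℤ.≤ Qn ℤ.* + suc N →
                   Rn ℤ.* + suc Qd ≡ (+ b ℤ.* Qn) ℤ.* + suc Rd →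
                   Rn ℤ.≤ + k ℤ.* + suc Rd →
                   b ℕ.* t ℕ.≤ k ℕ.* suc N
  cross-multiply {b} {t} {k} {N} {Qd} {Rd} {Qn} {Rn} t/N≤q r≡bq r≤k =
    ℕ≤ (ℤ.*-cancelʳ-≤-pos _ _ (+ suc Qd ℤ.* + suc Rd) (begin
    (+ b ℤ.* + t) ℤ.* (+ suc Qd ℤ.* + suc Rd)      ≡⟨ swap₁ (+ b) (+ t) (+ suc Qd) (+ suc Rd) ⟩
    (+ t ℤ.* + suc Qd) ℤ.* (+ b ℤ.* + suc Rd)      ≤⟨ ℤ.*-monoʳ-≤-nonNeg _ {{nonNeg b (suc Rd)}} t/N≤q ⟩
    (Qn ℤ.* + suc N) ℤ.* (+ b ℤ.* + suc Rd)        ≡⟨ swap₂ (+ b) Qn (+ suc N) (+ suc Rd) ⟩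
    ((+ b ℤ.* Qn) ℤ.* + suc Rd) ℤ.* + suc N        ≡⟨ cong (ℤ._* + suc N) r≡bq ⟨
    (Rn ℤ.* + suc Qd) ℤ.* + suc N                  ≤⟨ ℤ.*-monoʳ-≤-nonNeg _ (ℤ.*-monoʳ-≤-nonNeg _ r≤k) ⟩
    ((+ k ℤ.* + suc Rd) ℤ.* + suc Qd) ℤ.* + suc N  ≡⟨ swap₃ (+ k) (+ suc Rd) (+ suc Qd) (+ suc N) ⟩
    (+ k ℤ.* + suc N) ℤ.* (+ suc Qd ℤ.* + suc Rd)  ∎))
    where
    open ℤ.≤-Reasoning
    nonNeg : ∀ m n → ℤ.NonNegative (+ m ℤ.* + n)
    nonNeg m n = subst ℤ.NonNegative (ℤ.pos-* m n) _
    swap₁ : ∀ b t qd rd → (b ℤ.* t) ℤ.* (qd ℤ.* rd) ≡ (t ℤ.* qd) ℤ.* (b ℤ.* rd)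
    swap₁ = solve-∀
    swap₂ : ∀ b qn n rd → (qn ℤ.* n) ℤ.* (b ℤ.* rd) ≡ ((b ℤ.* qn) ℤ.* rd) ℤ.* n
    swap₂ = solve-∀
    swap₃ : ∀ k rd qd n → ((k ℤ.* rd) ℤ.* qd) ℤ.* n ≡ (k ℤ.* n) ℤ.* (qd ℤ.* rd)
    swap₃ = solve-∀
    ℕ≤ : + b ℤ.* + t ℤ.≤ + k ℤ.* + suc N → b ℕ.* t ℕ.≤ k ℕ.* suc N
    ℕ≤ le with subst₂ ℤ._≤_ (sym (ℤ.pos-* b t)) (sym (ℤ.pos-* k (suc N))) le
    ... | +≤+ le′ = le′

  fraction≤⇒cross : ∀ {t N} (q : ℚ) → + t / suc N ≤ q → + t ℤ.* ↧ q ℤ.≤ ↥ q ℤ.* + suc N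
  fraction≤⇒cross {t} {N} q@record{} t/N≤q
    with ℚᵘ.≤-respˡ-≃ (toℚᵘ-fromℚᵘ (ℚᵘ.mkℚᵘ (+ t) N)) (toℚᵘ-mono-≤ t/N≤q)
  ... | ℚᵘ.*≤* le = le

  scaled-cross : ∀ b (q : ℚ) → ↥ ((+ b / 1) * q) ℤ.* ↧ q ≡ (+ b ℤ.* ↥ q) ℤ.* ↧ ((+ b / 1) * q)
  scaled-cross b q@record{}
    with ℚᵘ.≃-trans (toℚᵘ-homo-* (+ b / 1) q)
                    (ℚᵘ.*-cong (toℚᵘ-fromℚᵘ (ℚᵘ.mkℚᵘ (+ b) 0)) (ℚᵘ.≃-refl {toℚᵘ q}))
  ... | ℚᵘ.*≡* eq =
    subst₂ _≡_ (cong₂ ℤ._*_ (↥ᵘ-toℚᵘ r) (cong (λ d → + suc d) (ℕ.+-identityʳ (ℚ.denominator-1 q))))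
               (cong ((+ b ℤ.* ↥ q) ℤ.*_) (↧ᵘ-toℚᵘ r)) eq
    where
    r : ℚ
    r = (+ b / 1) * q

  ceiling-bound : ∀ (q : ℚ) b k t N .{{_ : NonZero N}} → + t / N ≤ q → + k ≡ ⌈ (+ b / 1) * q ⌉ →
                  b ℕ.* t ℕ.≤ k ℕ.* N
  ceiling-bound q b k t (suc N) t/N≤q k≡⌈bq⌉ =
    cross-multiply {b} {t} {k} {N} (fraction≤⇒cross {t} {N} q t/N≤q) (scaled-cross b q)
                   (subst (λ x → ↥ r ℤ.≤ x ℤ.* ↧ r) (sym k≡⌈bq⌉) (↥≤ceiling*↧ r))
    where
    r : ℚ
    r = (+ b / 1) * q

module Hakimi {n : ℕ} (H : SimpleGraph n) where

  open import Data.Nat hiding (_≟_)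
  open import Data.Nat.Properties hiding (_≟_)
  open import Data.Fin using (Fin; toℕ)
  open import Data.Fin.Subset using (∣_∣)
  open import Data.Bool using (Bool; true; _∨_)
  open import Data.Bool.Properties using (∨-zeroʳ)
  open import Data.Vec using (tabulate)
  open import Data.Integer using (+_)
  open import Data.Rational using (ceiling) renaming (_/_ to _/ℚ_; _*_ to _*ℚ_)
  open import Data.Product using (_,_; proj₁; proj₂)
  open import Function using (const)
  open import Relation.Nullary using (yes; no)
  open import Relation.Binary.PropositionalEquality
  open FiniteSums
  open FiniteSets
  open SupplyDemand
  open CeilingArithmetic

  tail head : Fin (m H) → Fin n
  tail e = proj₁ (ends H e)
  head e = proj₂ (ends H e)

  tail≢head : ∀ e → tail e ≢ head e
  tail≢head e eq = <-irrefl (cong toℕ eq) (ordered H e)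

  incident : Fin (m H) → Fin n → Bool
  incident e x = ⁅ tail e ⁆ x ∨ ⁅ head e ⁆ x

  incident-tail : ∀ e → incident e (tail e) ≡ true
  incident-tail e = cong (_∨ ⁅ head e ⁆ (tail e)) (∈⁅⁆ (tail e))

  incident-head : ∀ e → incident e (head e) ≡ true
  incident-head e = trans (cong (⁅ tail e ⁆ (head e) ∨_) (∈⁅⁆ (head e))) (∨-zeroʳ _)

  spanned : (T : FinSet (m H)) → NonZero (∑[ N incident T ] const 1) → Subgraph H
  spanned T nonempty = record
    { V'       = tabulate (N incident T)
    ; E'       = tabulate T
    ; closed   = λ e e∈T → ∈tabulate (N-intro incident {T} (∈tabulate⁻ e∈T) (incident-tail e))
                         , ∈tabulate (N-intro incident {T} (∈tabulate⁻ e∈T) (incident-head e))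
    ; nonempty = subst NonZero (sym (∣tabulate∣ (N incident T))) nonempty
    }

  density⇒hall : ∀ {q b k} → IsDensity H q → + k ≡ ceiling ((+ b /ℚ 1) *ℚ q) →
                 HallCondition incident (const b) (const k)
  density⇒hall {q} {b} {k} density k≡⌈bq⌉ T with 0 <? ∑[ T ] const 1
  ... | no  T≡∅ = ≤-trans (≤-reflexive (trans (∑-const T b) (cong (_* b) (n≤0⇒n≡0 (≮⇒≥ T≡∅))))) z≤n
  ... | yes T≢∅ = subst₂ _≤_ (sym (trans (∑-const T b) (*-comm _ b)))
                             (sym (trans (∑-const (N incident T) k) (*-comm _ k)))
                             (subst₂ (λ x y → b * x ≤ k * y) (∣tabulate∣ T) (∣tabulate∣ (N incident T))
                                     (ceiling-bound q b k ∣ tabulate T ∣ ∣ tabulate (N incident T) ∣ {{nonempty S}}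
                                                    (proj₂ density S) k≡⌈bq⌉))
    where
    N≢∅ : NonZero (∑[ N incident T ] const 1)
    N≢∅ with ∑>0⇒∃∈ T (const 1) T≢∅
    ... | e , Te = >-nonZero (∈⇒≤∑ {A = N incident T} (const 1) (N-intro incident {T} Te (incident-tail e)))
    S : Subgraph H
    S = spanned T N≢∅

module MatchingColouring where

  open import Data.Nat hiding (_≟_)
  open import Data.Nat.Properties hiding (_≟_)
  open import Data.Fin using (Fin; splitAt; _↑ˡ_; _↑ʳ_)
  open import Data.Fin.Properties using (splitAt-↑ˡ; splitAt-↑ʳ; ↑ˡ-injective)
  open import Data.Bool using (true; false; if_then_else_; _∨_)
  open import Data.Maybe using (Maybe; just; nothing)
  open import Data.Product using (Σ; _×_; _,_; proj₁; proj₂)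
  open import Function.Definitions using (Injective)
  open import Data.Sum using (_⊎_; inj₁; inj₂)
  open import Data.Empty using (⊥; ⊥-elim)
  open import Function using (const)
  open import Relation.Binary.PropositionalEquality
  open FiniteSums
  open FiniteSets
  open SupplyDemand
  open Birkhoff
  open FunctionalGraphs

  𝟙+𝟙≤𝟙-∨ : ∀ x y → (x ≡ true → y ≡ true → ⊥) → 𝟙 x + 𝟙 y ≤ 𝟙 (x ∨ y)
  𝟙+𝟙≤𝟙-∨ true  true  exclusive = ⊥-elim (exclusive refl refl)
  𝟙+𝟙≤𝟙-∨ true  false _         = ≤-refl
  𝟙+𝟙≤𝟙-∨ false true  _         = ≤-refl
  𝟙+𝟙≤𝟙-∨ false false _         = ≤-refl

  module _ {n : ℕ} (H : SimpleGraph n) {b k : ℕ} (b≤k : b ≤ k)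
           (distribution : Transport (Hakimi.incident H) (const b) (const k)) where

    open Hakimi H using (tail; head; tail≢head)
    open Transport distribution

    flow-at-ends : ∀ e → flow e (tail e) + flow e (head e) ≡ b
    flow-at-ends e = trans (sym (sum≡two (flow e) (tail≢head e) off-ends)) (supply e)
      where
      off-ends : ∀ x → x ≢ tail e → x ≢ head e → flow e x ≡ 0
      off-ends x x≢tail x≢head = along-R e x (cong₂ _∨_ (≢⇒∉⁅⁆ (λ tail≡x → x≢tail (sym tail≡x)))
                                                        (≢⇒∉⁅⁆ (λ head≡x → x≢head (sym head≡x))))

    blocks : Fin n ⊎ Fin (m H) → Fin n ⊎ Fin (m H) → ℕ
    blocks (inj₁ x) (inj₂ e) = flow e x
    blocks _        _        = 0

    incidence : Matrix (n + m H)
    incidence a c = blocks (splitAt n a) (splitAt n c)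

    vertex : Fin n → Fin (n + m H)
    vertex x = x ↑ˡ m H

    edge : Fin (m H) → Fin (n + m H)
    edge e = n ↑ʳ e

    incidence-flow : ∀ x e → incidence (vertex x) (edge e) ≡ flow e x
    incidence-flow x e rewrite splitAt-↑ˡ n x (m H) | splitAt-↑ʳ n (m H) e = refl

    incidence-bounded : Bounded k incidence
    incidence-bounded = record
      { rows = λ a → row≤ (splitAt n a)
      ; cols = λ c → col≤ (splitAt n c)
      }
      where
      row≤ : ∀ s → sum (λ c → blocks s (splitAt n c)) ≤ k
      row≤ (inj₁ x) = subst (_≤ k) (sym (trans (sum-splitAt n (blocks (inj₁ x)))
                                               (cong (_+ sum (λ e → flow e x)) (sum-replicate-zero n))))
                            (capacity x)
      row≤ (inj₂ e) = subst (_≤ k) (sym (sum-replicate-zero (n + m H))) z≤n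
      col≤ : ∀ s → sum (λ a → blocks (splitAt n a) s) ≤ k
      col≤ (inj₁ y) = subst (_≤ k) (sym (trans (sum-splitAt n (λ s → blocks s (inj₁ y)))
                                               (cong₂ _+_ (sum-replicate-zero n) (sum-replicate-zero (m H))))) z≤n
      col≤ (inj₂ e) = subst (_≤ k) (sym (trans (sum-splitAt n (λ s → blocks s (inj₂ e)))
                                               (trans (cong (sum (flow e) +_) (sum-replicate-zero (m H))) (+-identityʳ _))))
                            (subst (_≤ k) (sym (supply e)) b≤k)

    private
      padding : Padding k incidence
      padding = pad incidence-bounded
      open Padding padding using (padded; dominates)
      decomposition : Decomposition k padded
      decomposition = decompose k (Padding.regular padding)
      open Decomposition decomposition using (σ; injective; multiplicity)

    covers : Fin (m H) → FinSet k
    covers e c = ⁅ σ c (vertex (tail e)) ⁆ (edge e) ∨ ⁅ σ c (vertex (head e)) ⁆ (edge e)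

    b≤#covering : ∀ e → b ≤ ∑[ covers e ] const 1
    b≤#covering e = begin
      b                                             ≡⟨ flow-at-ends e ⟨
      flow e (tail e) + flow e (head e)             ≡⟨ cong₂ _+_ (incidence-flow (tail e) e)
                                                                 (incidence-flow (head e) e) ⟨
      incidence u ε + incidence v ε                 ≤⟨ +-mono-≤ (dominates u ε) (dominates v ε) ⟩
      padded u ε + padded v ε                       ≡⟨ cong₂ _+_ (multiplicity u ε) (multiplicity v ε) ⟨
      sum (λ c → δ (σ c u) ε) + sum (λ c → δ (σ c v) ε)
                                                    ≡⟨ ∑-distrib-+ (λ c → δ (σ c u) ε) (λ c → δ (σ c v) ε) ⟨
      sum (λ c → δ (σ c u) ε + δ (σ c v) ε)         ≤⟨ sum-mono-≤ (λ c → 𝟙+𝟙≤𝟙-∨ _ _ (exclusive c)) ⟩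
      ∑[ covers e ] const 1                         ∎
      where
      open ≤-Reasoning
      u v ε : Fin (n + m H)
      u = vertex (tail e)
      v = vertex (head e)
      ε = edge e
      exclusive : ∀ c → ⁅ σ c u ⁆ ε ≡ true → ⁅ σ c v ⁆ ε ≡ true → ⊥
      exclusive c σu≡ε σv≡ε = tail≢head e (↑ˡ-injective (m H) (tail e) (head e)
        (injective c (trans (∈⁅⁆⇒≡ {i = σ c u} σu≡ε) (sym (∈⁅⁆⇒≡ {i = σ c v} σv≡ε)))))

    private
      chosen : ∀ e → Σ (Fin b → Fin k) λ g → (∀ j → covers e (g j) ≡ true) × Injective _≡_ _≡_ g
      chosen e = choose (covers e) b (b≤#covering e)

    colour : Colouring H b k
    colour e = proj₁ (chosen e)

    colour-covers : ∀ e j → covers e (colour e j) ≡ true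
    colour-covers e = proj₁ (proj₂ (chosen e))

    colour-simple : ∀ i → PartSimple H colour i
    colour-simple i e j j′ cj≡i cj′≡i = proj₂ (proj₂ (chosen e)) (trans cj≡i (sym cj′≡i))

    -- Padding may match x to an edge not at x; the pointer this yields is harmless, since only
    -- the edges of a colour are required to follow out.
    pointer : Fin n ⊎ Fin (m H) → Fin n → Maybe (Fin n)
    pointer (inj₁ _) x = nothing
    pointer (inj₂ e) x = just (if ⁅ tail e ⁆ x then head e else tail e)

    out : Fin k → Fin n → Maybe (Fin n)
    out c x = pointer (splitAt n (σ c (vertex x))) x

    out-edge : ∀ c x e → σ c (vertex x) ≡ edge e → out c x ≡ pointer (inj₂ e) x
    out-edge c x e σx≡e rewrite σx≡e | splitAt-↑ʳ n (m H) e = refl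

    covers⇒out : ∀ {c e} → covers e c ≡ true →
                 out c (tail e) ≡ just (head e) ⊎ out c (head e) ≡ just (tail e)
    covers⇒out {c} {e} covered with ⁅ σ c (vertex (tail e)) ⁆ (edge e) in at-tail
    ... | true  = inj₁ (trans (out-edge c (tail e) e (∈⁅⁆⇒≡ at-tail))
                              (cong (λ t → just (if t then _ else _)) (∈⁅⁆ (tail e))))
    ... | false = inj₂ (trans (out-edge c (head e) e (∈⁅⁆⇒≡ covered))
                              (cong (λ t → just (if t then _ else _)) (≢⇒∉⁅⁆ (tail≢head e))))

    reorient : ∀ {c a a′} (p : Fin n × Fin n) → p ≡ (a , a′) ⊎ p ≡ (a′ , a) →
               out c (proj₁ p) ≡ just (proj₂ p) ⊎ out c (proj₂ p) ≡ just (proj₁ p) →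
               out c a ≡ just a′ ⊎ out c a′ ≡ just a
    reorient _ (inj₁ refl) o         = o
    reorient _ (inj₂ refl) (inj₁ o)  = inj₂ o
    reorient _ (inj₂ refl) (inj₂ o)  = inj₁ o

    adjacent⇒out : ∀ c a a′ → Adj H colour c a a′ → out c a ≡ just a′ ⊎ out c a′ ≡ just a
    adjacent⇒out c a a′ (e , j , cj≡c , ends≡) =
      reorient (ends H e) ends≡ (covers⇒out (subst (λ i → covers e i ≡ true) cj≡c (colour-covers e j)))

    colour-unicyclic : ∀ c → ComponentsUnicyclic (Adj H colour c)
    colour-unicyclic c = functional⇒unicyclic (Adj H colour c) (out c) (adjacent⇒out c)

open import Data.Nat.Properties using (*-identityʳ)
open import Function using (const)
open import Data.Integer using (+_)
open import Data.Rational using (ℚ; _≤_; _*_; 1ℚ; ceiling; _/_)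
open import Data.Product using (Σ; _×_; _,_)
open import Data.Fin using (Fin)
open import Relation.Binary.PropositionalEquality using (_≡_; subst₂)
open SupplyDemand using (Transport; transport)
open CeilingArithmetic using (ceiling-bound)
open Hakimi using (incident; density⇒hall)
open MatchingColouring using (colour; colour-simple; colour-unicyclic)

lemma3p1 : {n : ℕ} (H : SimpleGraph n) (q : ℚ) → IsDensity H q → 1ℚ ≤ q →
           (b k : ℕ) → + k ≡ ⌈ (+ b / 1) * q ⌉ →
           Σ (Colouring H b k) λ c → (i : Fin k) →
             PartSimple H c i × ComponentsUnicyclic (Adj H c i)
lemma3p1 H q density 1≤q b k k≡⌈bq⌉ =
  colour H b≤k distribution ,
  λ i → colour-simple H b≤k distribution i , colour-unicyclic H b≤k distribution i
  where
  b≤k : b ℕ.≤ k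
  b≤k = subst₂ ℕ._≤_ (*-identityʳ b) (*-identityʳ k) (ceiling-bound q b k 1 1 1≤q k≡⌈bq⌉)
  distribution : Transport (incident H) (const b) (const k)
  distribution = transport (incident H) (density⇒hall H density k≡⌈bq⌉)
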